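{- For every list $Q$ of sequences (as in the context), the optimal objective value of the following integer linear program equals the minimum number $p$ such that there is a processing of $Q$ in which in each configuration at most $p$ pallets are open. Variables: binary $x_i^j$ for $i,j\in[n]$; an integer variable $p$; binary $g(t,c),h(t,c),f(t,c)$ for $t\in[m]$, $c\in[n-1]$. Minimize $p$ subject to: (1) $\sum_{j=1}^n x_i^j=1$ for every $i\in[n]$, and $\sum_{i=1}^n x_i^j=1$ for every $j\in[n]$; (2) for every $\ell\in[k]$, all $i,i'$ with $n_{\ell-1}+1\le i<i'\le n_\ell$ and all $j,j'\in[n]$ with $j'<j$: $x_{i'}^{j'}\le 1-x_i^j$; and for every $\ell\in[k]$, all $i,i'$ with $n_{\ell-1}+1\le i'<i\le n_\ell$ and all $j,j'\in[n]$ with $j'>j$: $x_{i'}^{j'}\le 1-x_i^j$; (3) $\sum_{t=1}^m f(t,c)\le p$ for every $c\in[n-1]$; (4) $x_i^j-g(t,c)\le 0$ for all $t\in[m]$, $c\in[n-1]$, $i\in[n]$ with ${\it plt}(b_i)=t$, $j\le c$; and $\sum_{i\in[n],\,j\le c,\,{\it plt}(b_i)=t} x_i^j - g(t,c)\ge 0$ for all $t\in[m]$, $c\in[n-1]$; (5) $x_i^j-h(t,c)\le 0$ for all $t\in[m]$, $c\in[n-1]$, $i\in[n]$ with ${\it plt}(b_i)=t$, $j> c$; and $\sum_{i\in[n],\,j> c,\,{\it plt}(b_i)=t} x_i^j - h(t,c)\ge 0$ for all $t\in[m]$, $c\in[n-1]$; (6) $f(t,c)-g(t,c)\le 0$, $f(t,c)-h(t,c)\le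 0$, and $g(t,c)+h(t,c)-f(t,c)\le 1$ for all $t\in[m]$, $c\in[n-1]$.
   Context: FIFO Stack-Up problem. An instance consists of a list $Q=(q_1,\ldots,q_k)$ of sequences of pairwise distinct bins, where the bins are numbered $b_1,\ldots,b_n$ so that $q_\ell=(b_{n_{\ell-1}+1},\ldots,b_{n_\ell})$ with $0=n_0<n_1<\cdots<n_k=n$; each bin $b$ has a pallet symbol ${\it plt}(b)$, and the distinct pallet symbols (pallets) are $1,\ldots,m$. Standing assumption: every pallet is carried by at least two bins. A configuration is a tuple $(i_1,\ldots,i_k)$ with $0\le i_j\le |q_j|$, meaning that the first $i_j$ bins of $q_j$ have been removed. A pallet $t$ is open in configuration $(i_1,\ldots,i_k)$ if there are indices $j,\ell$ such that some bin for $t$ is at a position $\le i_j$ in $q_j$ and some bin for $t$ is at a position $> i_\ell$ in $q_\ell$. A transformation step removes the bin at position $i_j+1$ of some sequence $q_j$ (with $i_j<|q_j|$). A processing of $Q$ is a sequence of transformation steps from $(0,\ldots,0)$ to $(|q_1|,\ldots,|q_k|)$. $[n]=\{1,\ldots,n\}$. -}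

module Defs where

open import Data.Nat as ℕ using (ℕ; zero; suc; _+_; _∸_; _≤_; _<_; _≡ᵇ_; _≤ᵇ_; _<ᵇ_)
open import Data.Integer as ℤ using (ℤ; +_)
open import Data.Bool using (Bool; true; false; _∧_; _∨_; if_then_else_)
open import Data.List using (List; []; _∷_)
open import Data.Product using (Σ; ∃; _×_; _,_)
open import Relation.Binary.PropositionalEquality using (_≡_; _≢_)

-- All indices are 1-based natural numbers, as in the paper:
--   sequences ℓ ∈ [k], bins i ∈ [n], pallets t ∈ [m].
-- bd ℓ = n_ℓ, so q_ℓ = (b_{n_{ℓ-1}+1}, …, b_{n_ℓ}) and n = n_k.
-- plt i = plt(b_i).  Bins are pairwise distinct by construction
-- (they are the distinct indices 1..n).

record Instance : Set where
  field
    k     : ℕ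
    bd    : ℕ → ℕ
    m     : ℕ
    plt   : ℕ → ℕ
    bd-0  : bd 0 ≡ 0
    bd-<  : ∀ ℓ → ℓ ℕ.< k → bd ℓ ℕ.< bd (suc ℓ)
    plt-range : ∀ i → 1 ≤ i → i ≤ bd k → (1 ≤ plt i) × (plt i ≤ m)
    two-bins  : ∀ t → 1 ≤ t → t ≤ m →
                Σ ℕ λ i → Σ ℕ λ i' → i ≢ i' × (1 ≤ i) × (i ≤ bd k) × (1 ≤ i') × (i' ≤ bd k)
                  × (plt i ≡ t) × (plt i' ≡ t)

module _ (Q : Instance) where
  open Instance Q

  nBins : ℕ
  nBins = bd k

  len : ℕ → ℕ
  len ℓ = bd ℓ ∸ bd (ℓ ∸ 1)

  binAt : ℕ → ℕ → ℕ
  binAt ℓ r = bd (ℓ ∸ 1) + r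

anyUpTo : ℕ → (ℕ → Bool) → Bool
anyUpTo zero    P = false
anyUpTo (suc n) P = anyUpTo n P ∨ P (suc n)

anyIn : ℕ → ℕ → (ℕ → Bool) → Bool
anyIn a b P = anyUpTo b (λ r → (a ℕ.≤ᵇ r) ∧ P r)

countUpTo : ℕ → (ℕ → Bool) → ℕ
countUpTo zero    P = zero
countUpTo (suc n) P = countUpTo n P + (if P (suc n) then 1 else 0)

-- a configuration (i_1, …, i_k), stored as ℓ ↦ i_ℓ (only ℓ ∈ [k] matter)
Config : Set
Config = ℕ → ℕ

module _ (Q : Instance) where
  open Instance Q

  isOpen : Config → ℕ → Bool
  isOpen c t =
    anyIn 1 k (λ j → anyIn 1 (c j) (λ r → plt (binAt Q j r) ≡ᵇ t))
    ∧ anyIn 1 k (λ ℓ → anyIn (suc (c ℓ)) (len Q ℓ) (λ r → plt (binAt Q ℓ r) ≡ᵇ t))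

  openCount : Config → ℕ
  openCount c = countUpTo m (isOpen c)

  initial : Config
  initial _ = 0

  -- transformation step: remove the bin at position i_j + 1 of q_j
  step : Config → ℕ → Config
  step c j ℓ = if ℓ ≡ᵇ j then suc (c ℓ) else c ℓ

  -- A list of steps js (each naming the sequence q_j acted on), starting in
  -- configuration c, is a valid sequence of transformation steps reaching
  -- (|q_1|, …, |q_k|), and every configuration visited (including c and the
  -- final one) has at most p open pallets.
  RunBounded : ℕ → Config → List ℕ → Set
  RunBounded p c []       = (openCount c ≤ p) × (∀ ℓ → 1 ≤ ℓ → ℓ ≤ k → c ℓ ≡ len Q ℓ)
  RunBounded p c (j ∷ js) = (openCount c ≤ p) × (1 ≤ j) × (j ≤ k) × (c j ℕ.< len Q j)
                            × RunBounded p (step c j) js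

  ProcessableWith : ℕ → Set
  ProcessableWith p = Σ (List ℕ) λ js → RunBounded p initial js

  IsMinProcessing : ℕ → Set
  IsMinProcessing v = ProcessableWith v × (∀ p → ProcessableWith p → v ≤ p)

sumTo : ℕ → (ℕ → ℤ) → ℤ
sumTo zero    f = + 0
sumTo (suc n) f = sumTo n f ℤ.+ f (suc n)

Binary : ℤ → Set
Binary z = (+ 0 ℤ.≤ z) × (z ℤ.≤ + 1)

record Assignment : Set where
  field
    x : ℕ → ℕ → ℤ
    p : ℤ
    g : ℕ → ℕ → ℤ
    h : ℕ → ℕ → ℤ
    f : ℕ → ℕ → ℤ

module _ (Q : Instance) (A : Assignment) where
  open Instance Q
  open Assignment A

  private
    n = nBins Q
    In : ℕ → ℕ → ℕ → Set
    In a b v = (a ≤ v) × (v ≤ b)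

  Feasible : Set
  Feasible =
      (∀ i j → In 1 n i → In 1 n j → Binary (x i j))
    × (∀ t c → In 1 m t → In 1 (n ∸ 1) c → Binary (g t c) × Binary (h t c) × Binary (f t c))
    × (∀ i → In 1 n i → sumTo n (λ j → x i j) ≡ + 1)
    × (∀ j → In 1 n j → sumTo n (λ i → x i j) ≡ + 1)
    × (∀ ℓ i i' j j' → In 1 k ℓ → suc (bd (ℓ ∸ 1)) ≤ i → i < i' → i' ≤ bd ℓ →
         In 1 n j → In 1 n j' → j' < j → x i' j' ℤ.≤ + 1 ℤ.- x i j)
    × (∀ ℓ i i' j j' → In 1 k ℓ → suc (bd (ℓ ∸ 1)) ≤ i' → i' < i → i ≤ bd ℓ →
         In 1 n j → In 1 n j' → j < j' → x i' j' ℤ.≤ + 1 ℤ.- x i j)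
    × (∀ c → In 1 (n ∸ 1) c → sumTo m (λ t → f t c) ℤ.≤ p)
    × (∀ t c i j → In 1 m t → In 1 (n ∸ 1) c → In 1 n i → plt i ≡ t → In 1 n j → j ≤ c →
         x i j ℤ.- g t c ℤ.≤ + 0)
    × (∀ t c → In 1 m t → In 1 (n ∸ 1) c →
         + 0 ℤ.≤ sumTo n (λ i → if plt i ≡ᵇ t then sumTo n (λ j → if j ≤ᵇ c then x i j else + 0) else + 0)
                 ℤ.- g t c)
    × (∀ t c i j → In 1 m t → In 1 (n ∸ 1) c → In 1 n i → plt i ≡ t → In 1 n j → c < j →
         x i j ℤ.- h t c ℤ.≤ + 0)
    × (∀ t c → In 1 m t → In 1 (n ∸ 1) c →
         + 0 ℤ.≤ sumTo n (λ i → if plt i ≡ᵇ t then sumTo n (λ j → if c <ᵇ j then x i j else + 0) else + 0)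
                 ℤ.- h t c)
    × (∀ t c → In 1 m t → In 1 (n ∸ 1) c →
         (f t c ℤ.- g t c ℤ.≤ + 0) × (f t c ℤ.- h t c ℤ.≤ + 0)
         × (g t c ℤ.+ h t c ℤ.- f t c ℤ.≤ + 1))

IsILPOptimum : Instance → ℤ → Set
IsILPOptimum Q v =
  (Σ Assignment λ A → Feasible Q A × Assignment.p A ≡ v)
  × (∀ A → Feasible Q A → v ℤ.≤ Assignment.p A)

module Submission where

-- A processing of Q and a feasible solution of the ILP encode the same object:
-- the order in which the n bins are removed.  In the ILP, x_i^j = 1 says that
-- bin b_i is removed at the j-th step, g(t,c) (resp. h(t,c)) says that some
-- bin of pallet t has (resp. has not) been removed after c steps, and
-- f(t,c) = g ∧ h says that t is open after c steps.

open import Defs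
open import Data.Nat using (ℕ; _≤_)
open import Data.Integer using (+_)
open import Data.Product using (Σ; _×_)

open import Data.Nat using (zero; suc; _+_; _∸_; _<_; _≡ᵇ_; _≤ᵇ_; _<ᵇ_; z≤n; s≤s; _≟_; _≤?_; _<?_)
open import Data.Nat.Properties
open import Data.Integer as ℤ using (ℤ; -[1+_])
import Data.Integer.Properties as ℤP
open import Data.Bool using (Bool; true; false; _∧_; if_then_else_; not; T)
open import Data.Bool.Properties using (T-∧; T-∨; T-≡; T-not-≡)
open import Data.List using (List; []; _∷_; length)
open import Data.Product using (_,_; proj₁; proj₂)
open import Data.Sum using (_⊎_; inj₁; inj₂)
open import Data.Empty using (⊥; ⊥-elim)
open import Function.Bundles using (Equivalence)
open import Relation.Nullary using (¬_; Dec; yes; no)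
open import Relation.Nullary.Decidable using (T?; ⌊_⌋; toWitness; fromWitness)
open import Relation.Binary.PropositionalEquality
open import Relation.Binary using (tri<; tri≈; tri>)

open Equivalence using (to; from)

≤-pred-≢ : ∀ {a n} → a ≤ suc n → a ≢ suc n → a ≤ n
≤-pred-≢ a≤ a≢ = ≤-pred (≤∧≢⇒< a≤ a≢)

¬T⇒≡false : ∀ {x} → ¬ T x → x ≡ false
¬T⇒≡false {false} _  = refl
¬T⇒≡false {true}  ¬t = ⊥-elim (¬t _)

T-ext : ∀ {a b} → (T a → T b) → (T b → T a) → a ≡ b
T-ext {false} {false} _   _   = refl
T-ext {false} {true}  _   b⇒a = ⊥-elim (b⇒a _)
T-ext {true}  {false} a⇒b _   = ⊥-elim (a⇒b _)
T-ext {true}  {true}  _   _   = refl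

T-not⇒¬T : ∀ {b} → T (not b) → ¬ T b
T-not⇒¬T {true} () _

¬T⇒T-not : ∀ {b} → ¬ T b → T (not b)
¬T⇒T-not ¬b = from T-not-≡ (¬T⇒≡false ¬b)

-- The largest point of [1,n] satisfying P (0 if there is none).  It turns the
-- Boolean existentials of Defs into functions of the data.
lastIn : ℕ → (ℕ → Bool) → ℕ
lastIn zero    P = zero
lastIn (suc n) P = if P (suc n) then suc n else lastIn n P

lastIn-spec : ∀ n P → T (anyUpTo n P) → (1 ≤ lastIn n P) × (lastIn n P ≤ n) × T (P (lastIn n P))
lastIn-spec zero P ()
lastIn-spec (suc n) P any with P (suc n) in Psn
... | true  = s≤s z≤n , ≤-refl , from T-≡ Psn
... | false with to T-∨ any
...   | inj₁ any' = let (lo , hi , P') = lastIn-spec n P any' in lo , m≤n⇒m≤1+n hi , P'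
...   | inj₂ ()

anyUpTo-intro : ∀ n P a → 1 ≤ a → a ≤ n → T (P a) → T (anyUpTo n P)
anyUpTo-intro zero    P a 1≤a a≤0 _ = ⊥-elim (<⇒≱ 1≤a a≤0)
anyUpTo-intro (suc n) P a 1≤a a≤ Pa with a ≟ suc n
... | yes refl = from T-∨ (inj₂ Pa)
... | no a≢    = from T-∨ (inj₁ (anyUpTo-intro n P a 1≤a (≤-pred-≢ a≤ a≢) Pa))

anyIn-intro : ∀ a b P r → 1 ≤ a → a ≤ r → r ≤ b → T (P r) → T (anyIn a b P)
anyIn-intro a b P r 1≤a a≤r r≤b Pr =
  anyUpTo-intro b (λ r → (a ≤ᵇ r) ∧ P r) r (≤-trans 1≤a a≤r) r≤b (from T-∧ (≤⇒≤ᵇ a≤r , Pr))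

anyIn-elim : ∀ a b P → T (anyIn a b P) → Σ ℕ λ r → (a ≤ r) × (r ≤ b) × T (P r)
anyIn-elim a b P any with lastIn-spec b _ any
... | _ , r≤b , aP = let (a≤r , Pr) = to T-∧ aP in _ , ≤ᵇ⇒≤ a _ a≤r , r≤b , Pr

all?-upTo : ∀ K (P : ℕ → Set) → (∀ ℓ → Dec (P ℓ)) → Dec (∀ ℓ → 1 ≤ ℓ → ℓ ≤ K → P ℓ)
all?-upTo zero    P P? = yes λ ℓ 1≤ℓ ℓ≤0 → ⊥-elim (<⇒≱ 1≤ℓ ℓ≤0)
all?-upTo (suc K) P P? with all?-upTo K P P? | P? (suc K)
... | no ¬all | _      = no λ all → ¬all λ ℓ 1≤ℓ ℓ≤K → all ℓ 1≤ℓ (m≤n⇒m≤1+n ℓ≤K)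
... | _       | no ¬P  = no λ all → ¬P (all (suc K) (s≤s z≤n) ≤-refl)
... | yes all | yes PK = yes extend
  where
  extend : ∀ ℓ → 1 ≤ ℓ → ℓ ≤ suc K → P ℓ
  extend ℓ 1≤ℓ ℓ≤ with ℓ ≟ suc K
  ... | yes refl = PK
  ... | no ℓ≢    = all ℓ 1≤ℓ (≤-pred-≢ ℓ≤ ℓ≢)

any?-upTo : ∀ K (P : ℕ → Set) → (∀ ℓ → Dec (P ℓ)) → Dec (Σ ℕ λ ℓ → (1 ≤ ℓ) × (ℓ ≤ K) × P ℓ)
any?-upTo zero    P P? = no λ (ℓ , 1≤ℓ , ℓ≤0 , _) → <⇒≱ 1≤ℓ ℓ≤0
any?-upTo (suc K) P P? with P? (suc K) | any?-upTo K P P?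
... | yes PK | _ = yes (suc K , s≤s z≤n , ≤-refl , PK)
... | no _   | yes (ℓ , 1≤ℓ , ℓ≤K , Pℓ) = yes (ℓ , 1≤ℓ , m≤n⇒m≤1+n ℓ≤K , Pℓ)
... | no ¬PK | no ¬any = no refute
  where
  refute : ¬ (Σ ℕ λ ℓ → (1 ≤ ℓ) × (ℓ ≤ suc K) × P ℓ)
  refute (ℓ , 1≤ℓ , ℓ≤ , Pℓ) with ℓ ≟ suc K
  ... | yes refl = ¬PK Pℓ
  ... | no ℓ≢    = ¬any (ℓ , 1≤ℓ , ≤-pred-≢ ℓ≤ ℓ≢ , Pℓ)

least-witness : (P : ℕ → Set) → (∀ a → Dec (P a)) → ∀ b → P b →
                Σ ℕ λ v → P v × (∀ a → P a → v ≤ a)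
least-witness P P? b Pb = search b 0 (λ _ ()) Pb
  where
  -- a is the next candidate, everything below it fails, r bounds the distance to b
  search : ∀ r a → (∀ a' → a' < a → ¬ P a') → P (a + r) → Σ ℕ λ v → P v × (∀ a → P a → v ≤ a)
  search r a below Par with P? a
  ... | yes Pa = a , Pa , λ a' Pa' → ≮⇒≥ λ a'<a → below a' a'<a Pa'
  search zero    a below Par | no ¬Pa = ⊥-elim (¬Pa (subst P (+-identityʳ a) Par))
  search (suc r) a below Par | no ¬Pa = search r (suc a) below' (subst P (+-suc a r) Par)
    where
    below' : ∀ a' → a' < suc a → ¬ P a'
    below' a' a'≤a with a' ≟ a
    ... | yes refl = ¬Pa
    ... | no a'≢a  = below a' (≤∧≢⇒< (≤-pred a'≤a) a'≢a)

ind : Bool → ℕ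
ind b = if b then 1 else 0

sumN : ℕ → (ℕ → ℕ) → ℕ
sumN zero    F = zero
sumN (suc n) F = sumN n F + F (suc n)

countUpTo-sum : ∀ n P → countUpTo n P ≡ sumN n (λ t → ind (P t))
countUpTo-sum zero    P = refl
countUpTo-sum (suc n) P = cong (_+ ind (P (suc n))) (countUpTo-sum n P)

countUpTo-≤ : ∀ n P → countUpTo n P ≤ n
countUpTo-≤ zero    P = z≤n
countUpTo-≤ (suc n) P with P (suc n)
... | true  = subst (_≤ suc n) (+-comm 1 (countUpTo n P)) (s≤s (countUpTo-≤ n P))
... | false = subst (_≤ suc n) (sym (+-identityʳ (countUpTo n P))) (m≤n⇒m≤1+n (countUpTo-≤ n P))

sumTo-+ : ∀ n F → sumTo n (λ i → + F i) ≡ + sumN n F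
sumTo-+ zero    F = refl
sumTo-+ (suc n) F = cong (ℤ._+ + F (suc n)) (sumTo-+ n F)

sumTo-cong : ∀ n F G → (∀ i → 1 ≤ i → i ≤ n → F i ≡ G i) → sumTo n F ≡ sumTo n G
sumTo-cong zero    F G F≡G = refl
sumTo-cong (suc n) F G F≡G =
  cong₂ ℤ._+_ (sumTo-cong n F G λ i 1≤i i≤n → F≡G i 1≤i (m≤n⇒m≤1+n i≤n)) (F≡G (suc n) (s≤s z≤n) ≤-refl)

sumN-cong : ∀ n F G → (∀ i → 1 ≤ i → i ≤ n → F i ≡ G i) → sumN n F ≡ sumN n G
sumN-cong zero    F G F≡G = refl
sumN-cong (suc n) F G F≡G =
  cong₂ _+_ (sumN-cong n F G λ i 1≤i i≤n → F≡G i 1≤i (m≤n⇒m≤1+n i≤n)) (F≡G (suc n) (s≤s z≤n) ≤-refl)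

sumN-mono : ∀ n F G → (∀ i → 1 ≤ i → i ≤ n → F i ≤ G i) → sumN n F ≤ sumN n G
sumN-mono zero    F G F≤G = z≤n
sumN-mono (suc n) F G F≤G =
  +-mono-≤ (sumN-mono n F G λ i 1≤i i≤n → F≤G i 1≤i (m≤n⇒m≤1+n i≤n)) (F≤G (suc n) (s≤s z≤n) ≤-refl)

sumN-zero : ∀ n F → (∀ i → 1 ≤ i → i ≤ n → F i ≡ 0) → sumN n F ≡ 0
sumN-zero zero    F F≡0 = refl
sumN-zero (suc n) F F≡0 =
  cong₂ _+_ (sumN-zero n F λ i 1≤i i≤n → F≡0 i 1≤i (m≤n⇒m≤1+n i≤n)) (F≡0 (suc n) (s≤s z≤n) ≤-refl)

countUpTo-none : ∀ n P → (∀ t → 1 ≤ t → t ≤ n → ¬ T (P t)) → countUpTo n P ≡ 0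
countUpTo-none n P none =
  trans (countUpTo-sum n P) (sumN-zero n _ λ t 1≤t t≤n → cong ind (¬T⇒≡false (none t 1≤t t≤n)))

term≤sumN : ∀ n F a → 1 ≤ a → a ≤ n → F a ≤ sumN n F
term≤sumN zero    F a 1≤a a≤0 = ⊥-elim (<⇒≱ 1≤a a≤0)
term≤sumN (suc n) F a 1≤a a≤ with a ≟ suc n
... | yes refl = m≤n+m (F (suc n)) (sumN n F)
... | no a≢    = ≤-trans (term≤sumN n F a 1≤a (≤-pred-≢ a≤ a≢)) (m≤m+n (sumN n F) _)

twoTerms≤sumN : ∀ n F a b → 1 ≤ a → a < b → b ≤ n → F a + F b ≤ sumN n F
twoTerms≤sumN zero    F a b 1≤a a<b b≤0 = ⊥-elim (<⇒≱ (≤-trans 1≤a (<⇒≤ a<b)) b≤0)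
twoTerms≤sumN (suc n) F a b 1≤a a<b b≤ with b ≟ suc n
... | yes refl = +-monoˡ-≤ (F (suc n)) (term≤sumN n F a 1≤a (≤-pred a<b))
... | no b≢    = ≤-trans (twoTerms≤sumN n F a b 1≤a a<b (≤-pred-≢ b≤ b≢)) (m≤m+n (sumN n F) _)

sumN-point : ∀ n b → 1 ≤ b → b ≤ n → sumN n (λ i → ind (i ≡ᵇ b)) ≡ 1
sumN-point zero    b 1≤b b≤0 = ⊥-elim (<⇒≱ 1≤b b≤0)
sumN-point (suc n) b 1≤b b≤ with b ≟ suc n
... | yes refl = cong₂ _+_ (sumN-zero n _ λ i _ i≤n → off i (<⇒≢ (s≤s i≤n))) (on (suc n))
  where
  off : ∀ i → i ≢ b → ind (i ≡ᵇ b) ≡ 0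
  off i i≢b with i ≡ᵇ b in eq
  ... | true  = ⊥-elim (i≢b (≡ᵇ⇒≡ i b (from T-≡ eq)))
  ... | false = refl
  on : ∀ i → ind (i ≡ᵇ i) ≡ 1
  on i rewrite to T-≡ (≡⇒≡ᵇ i i refl) = refl
... | no b≢ with suc n ≡ᵇ b in eq
...   | true  = ⊥-elim (b≢ (sym (≡ᵇ⇒≡ (suc n) b (from T-≡ eq))))
...   | false = cong (_+ 0) (sumN-point n b 1≤b (≤-pred-≢ b≤ b≢))

Monotone : (ℕ → Bool) → Set
Monotone b = ∀ s → T (b s) → T (b (suc s))

switchOn : (ℕ → Bool) → ℕ → Bool
switchOn b s = b s ∧ not (b (s ∸ 1))

telescope : ∀ b → b 0 ≡ false → Monotone b → ∀ N → sumN N (λ s → ind (switchOn b s)) ≡ ind (b N)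
telescope b b0 mono zero rewrite b0 = refl
telescope b b0 mono (suc N) rewrite telescope b b0 mono N with b N in bN
... | true rewrite to T-≡ (mono N (from T-≡ bN)) = refl
... | false with b (suc N)
...   | true  = refl
...   | false = refl

switchOn-between : ∀ b a c → ¬ T (b a) → T (b c) → a ≤ c → Σ ℕ λ j → (a < j) × (j ≤ c) × T (switchOn b j)
switchOn-between b a zero    ¬ba bc z≤n = ⊥-elim (¬ba bc)
switchOn-between b a (suc c) ¬ba bc a≤ with a ≟ suc c | T? (b c)
... | yes refl | _     = ⊥-elim (¬ba bc)
... | no a≢    | yes bc' =
  let (j , a<j , j≤c , sw) = switchOn-between b a c ¬ba bc' (≤-pred-≢ a≤ a≢) in j , a<j , m≤n⇒m≤1+n j≤c , sw
... | no a≢    | no ¬bc = suc c , s≤s (≤-pred-≢ a≤ a≢) , ≤-refl , from T-∧ (bc , ¬T⇒T-not ¬bc)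

filtered-term≤sumN : ∀ n (P : ℕ → Bool) (F : ℕ → ℕ) a → 1 ≤ a → a ≤ n → T (P a) →
                     F a ≤ sumN n (λ i → if P i then F i else 0)
filtered-term≤sumN n P F a 1≤a a≤n Pa =
  subst (_≤ sumN n (λ i → if P i then F i else 0)) (passes (P a) Pa) (term≤sumN n _ a 1≤a a≤n)
  where
  passes : ∀ b → T b → (if b then F a else 0) ≡ F a
  passes true _ = refl

sumTo-filtered² : ∀ n (P : ℕ → Bool) (S : ℕ → ℕ → Bool) (B : ℕ → ℕ → ℕ) →
                  sumTo n (λ i → if P i then sumTo n (λ j → if S i j then + B i j else + 0) else + 0)
                    ≡ + sumN n (λ i → if P i then sumN n (λ j → if S i j then B i j else 0) else 0)
sumTo-filtered² n P S B = trans (sumTo-cong n _ _ λ i _ _ → row i) (sumTo-+ n _)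
  where
  if-+ : ∀ b a → (if b then + a else + 0) ≡ + (if b then a else 0)
  if-+ true  a = refl
  if-+ false a = refl
  row : ∀ i → (if P i then sumTo n (λ j → if S i j then + B i j else + 0) else + 0)
                ≡ + (if P i then sumN n (λ j → if S i j then B i j else 0) else 0)
  row i with P i
  ... | true  = trans (sumTo-cong n _ _ λ j _ _ → if-+ (S i j) (B i j)) (sumTo-+ n _)
  ... | false = refl

-- Linear inequalities satisfied by indicators of Booleans.  Every ILP
-- constraint (2), (4)–(6) instantiated by the assignment built from a
-- processing is one of these.
ind-binary : ∀ b → Binary (+ ind b)
ind-binary true  = ℤ.+≤+ z≤n , ℤ.+≤+ ≤-refl
ind-binary false = ℤ.+≤+ z≤n , ℤ.+≤+ z≤n

ind-exclusive : ∀ a b → (T a → T b → ⊥) → + ind a ℤ.≤ + 1 ℤ.- + ind b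
ind-exclusive true  true  excl = ⊥-elim (excl _ _)
ind-exclusive true  false excl = ℤ.+≤+ ≤-refl
ind-exclusive false true  excl = ℤ.+≤+ z≤n
ind-exclusive false false excl = ℤ.+≤+ z≤n

ind-implies : ∀ a b → (T a → T b) → + ind a ℤ.- + ind b ℤ.≤ + 0
ind-implies true  true  a⇒b = ℤ.+≤+ z≤n
ind-implies true  false a⇒b = ⊥-elim (a⇒b _)
ind-implies false true  a⇒b = ℤ.-≤+
ind-implies false false a⇒b = ℤ.+≤+ z≤n

ind-covered : ∀ a b → (T b → 1 ≤ a) → + 0 ℤ.≤ + a ℤ.- + ind b
ind-covered a       false b⇒1≤a = ℤ.+≤+ z≤n
ind-covered zero    true  b⇒1≤a with b⇒1≤a _
... | ()
ind-covered (suc a) true  b⇒1≤a = ℤ.+≤+ z≤n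

ind-∧ : ∀ a b → + ind a ℤ.+ + ind b ℤ.- + ind (a ∧ b) ℤ.≤ + 1
ind-∧ true  true  = ℤ.+≤+ ≤-refl
ind-∧ true  false = ℤ.+≤+ ≤-refl
ind-∧ false true  = ℤ.+≤+ ≤-refl
ind-∧ false false = ℤ.+≤+ z≤n

ind-T : ∀ {b} → T b → ind b ≡ 1
ind-T {true} _ = refl

-- Conversely, a binary integer is 0 or 1, and it is forced to be 1 by
-- 1 - y ≤ 0 (constraints (4)/(5) with x = 1) or by 1 + 1 - z ≤ 1 (constraint
-- (6) with g = h = 1).
binary-cases : ∀ z → Binary z → (z ≡ + 0) ⊎ (z ≡ + 1)
binary-cases (+ zero)          _ = inj₁ refl
binary-cases (+ suc zero)      _ = inj₂ refl
binary-cases (+ suc (suc n))   (_ , ℤ.+≤+ (s≤s ()))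
binary-cases -[1+ n ]          (() , _)

forced-by-upper : ∀ y → Binary y → + 1 ℤ.- y ℤ.≤ + 0 → y ≡ + 1
forced-by-upper y y01 le with binary-cases y y01
... | inj₂ y≡1 = y≡1
... | inj₁ refl with le
...   | ℤ.+≤+ ()

forced-by-sum : ∀ z → Binary z → + 1 ℤ.+ + 1 ℤ.- z ℤ.≤ + 1 → z ≡ + 1
forced-by-sum z z01 le with binary-cases z z01
... | inj₂ z≡1 = z≡1
... | inj₁ refl with le
...   | ℤ.+≤+ (s≤s ())

-- A family of binary integers on [1,n] summing to 1 takes the value 1 at
-- exactly one point, `one`.  Applied to the rows and columns of x
-- (constraint (1)) this makes x a permutation matrix.
module UniqueOne (n : ℕ) (F : ℕ → ℤ) where

  isOne : ℕ → Bool
  isOne i = ⌊ F i ℤ.≟ + 1 ⌋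

  one : ℕ
  one = lastIn n isOne

  module _ (F01 : ∀ i → 1 ≤ i → i ≤ n → Binary (F i)) (sum≡1 : sumTo n F ≡ + 1) where

    -- the family is natural-valued, so its sum is 1 over ℕ too
    sumℕ≡1 : sumN n (λ i → ℤ.∣ F i ∣) ≡ 1
    sumℕ≡1 = ℤP.+-injective (begin
      + sumN n (λ i → ℤ.∣ F i ∣)      ≡⟨ sumTo-+ n _ ⟨
      sumTo n (λ i → + ℤ.∣ F i ∣)     ≡⟨ sumTo-cong n _ F (λ i 1≤i i≤n → ℤP.0≤i⇒+∣i∣≡i (proj₁ (F01 i 1≤i i≤n))) ⟩
      sumTo n F                       ≡⟨ sum≡1 ⟩
      + 1                             ∎)
      where open ≡-Reasoning

    -- a family without a 1 would be 0 everywhere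
    some-one : T (anyUpTo n isOne)
    some-one with T? (anyUpTo n isOne)
    ... | yes any = any
    ... | no none = ⊥-elim (0≢1+n (trans (sym (sumN-zero n _ vanishes)) sumℕ≡1))
      where
      vanishes : ∀ i → 1 ≤ i → i ≤ n → ℤ.∣ F i ∣ ≡ 0
      vanishes i 1≤i i≤n with binary-cases (F i) (F01 i 1≤i i≤n)
      ... | inj₁ Fi≡0 rewrite Fi≡0 = refl
      ... | inj₂ Fi≡1 = ⊥-elim (none (anyUpTo-intro n isOne i 1≤i i≤n (fromWitness Fi≡1)))

    one-spec : (1 ≤ one) × (one ≤ n) × (F one ≡ + 1)
    one-spec = let (lo , hi , isone) = lastIn-spec n isOne some-one in lo , hi , toWitness isone

    no-two-ones : ∀ a b → 1 ≤ a → a < b → b ≤ n → F a ≡ + 1 → F b ≡ + 1 → ⊥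
    no-two-ones a b 1≤a a<b b≤n Fa≡1 Fb≡1 with twoTerms≤sumN n (λ i → ℤ.∣ F i ∣) a b 1≤a a<b b≤n
    ... | two≤sum rewrite Fa≡1 | Fb≡1 | sumℕ≡1 = 1+n≰n (≤-pred two≤sum)

    one-unique : ∀ a → 1 ≤ a → a ≤ n → F a ≡ + 1 → a ≡ one
    one-unique a 1≤a a≤n Fa≡1 with <-cmp a one
    ... | tri≈ _ a≡one _ = a≡one
    ... | tri< a<one _ _ = ⊥-elim (no-two-ones a one 1≤a a<one (proj₁ (proj₂ one-spec)) Fa≡1 (proj₂ (proj₂ one-spec)))
    ... | tri> _ _ one<a = ⊥-elim (no-two-ones one a (proj₁ one-spec) one<a a≤n (proj₂ (proj₂ one-spec)) Fa≡1)

-- The layout of an instance: the global bin indices 1..n are cut into the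
-- consecutive blocks (bd (ℓ ∸ 1), bd ℓ], block ℓ being the sequence q_ℓ.  Bins
-- are addressed either globally (i) or by a position (ℓ, r) with
-- binAt Q ℓ r = bd (ℓ ∸ 1) + r; the two addressings are in bijection.
module Layout (Q : Instance) where
  open Instance Q

  bd-mono : ∀ a b → a ≤ b → b ≤ k → bd a ≤ bd b
  bd-mono a zero    z≤n _ = ≤-refl
  bd-mono a (suc b) a≤ b<k with a ≟ suc b
  ... | yes refl = ≤-refl
  ... | no a≢    = ≤-trans (bd-mono a b (≤-pred-≢ a≤ a≢) (<⇒≤ b<k)) (<⇒≤ (bd-< b b<k))

  InSeq : ℕ → ℕ → Set
  InSeq ℓ i = (1 ≤ ℓ) × (ℓ ≤ k) × (bd (ℓ ∸ 1) < i) × (i ≤ bd ℓ)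

  Pos : ℕ → ℕ → Set
  Pos ℓ r = (1 ≤ ℓ) × (ℓ ≤ k) × (1 ≤ r) × (r ≤ len Q ℓ)

  InSeq-disjoint : ∀ ℓ ℓ' i → InSeq ℓ i → InSeq ℓ' i → ¬ (ℓ < ℓ')
  InSeq-disjoint ℓ ℓ' i (_ , _ , _ , i≤end) (_ , ℓ'≤k , start< , _) ℓ<ℓ' =
    <⇒≱ start< (≤-trans i≤end (bd-mono ℓ (ℓ' ∸ 1) (suc[m]≤n⇒m≤pred[n] ℓ<ℓ') (≤-trans (m∸n≤m ℓ' 1) ℓ'≤k)))

  InSeq-unique : ∀ ℓ ℓ' i → InSeq ℓ i → InSeq ℓ' i → ℓ ≡ ℓ'
  InSeq-unique ℓ ℓ' i inℓ inℓ' with <-cmp ℓ ℓ'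
  ... | tri< ℓ<ℓ' _ _ = ⊥-elim (InSeq-disjoint ℓ ℓ' i inℓ inℓ' ℓ<ℓ')
  ... | tri≈ _ ℓ≡ℓ' _ = ℓ≡ℓ'
  ... | tri> _ _ ℓ'<ℓ = ⊥-elim (InSeq-disjoint ℓ' ℓ i inℓ' inℓ ℓ'<ℓ)

  InSeq-exists : ∀ K i → K ≤ k → 1 ≤ i → i ≤ bd K → Σ ℕ λ ℓ → InSeq ℓ i
  InSeq-exists zero    i _   1≤i i≤ rewrite bd-0 = ⊥-elim (<⇒≱ 1≤i i≤)
  InSeq-exists (suc K) i K<k 1≤i i≤ with i ≤? bd K
  ... | yes i≤bdK = InSeq-exists K i (<⇒≤ K<k) 1≤i i≤bdK
  ... | no  i≰bdK = suc K , s≤s z≤n , K<k , ≰⇒> i≰bdK , i≤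

  seqOf : ℕ → ℕ
  seqOf i = lastIn k (λ ℓ → (bd (ℓ ∸ 1) <ᵇ i) ∧ (i ≤ᵇ bd ℓ))

  seqOf-spec : ∀ i → 1 ≤ i → i ≤ nBins Q → InSeq (seqOf i) i
  seqOf-spec i 1≤i i≤n with InSeq-exists k i ≤-refl 1≤i i≤n
  ... | ℓ , 1≤ℓ , ℓ≤k , start< , i≤end with lastIn-spec k _ (anyUpTo-intro k _ ℓ 1≤ℓ ℓ≤k (from T-∧ (<⇒<ᵇ start< , ≤⇒≤ᵇ i≤end)))
  ...   | lo , hi , test = let (start<′ , i≤end′) = to T-∧ test in lo , hi , <ᵇ⇒< _ _ start<′ , ≤ᵇ⇒≤ _ _ i≤end′

  bd-pred≤ : ∀ ℓ → ℓ ≤ k → bd (ℓ ∸ 1) ≤ bd ℓ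
  bd-pred≤ ℓ ℓ≤k = bd-mono (ℓ ∸ 1) ℓ (m∸n≤m ℓ 1) ℓ≤k

  Pos⇒InSeq : ∀ ℓ r → Pos ℓ r → InSeq ℓ (binAt Q ℓ r)
  Pos⇒InSeq ℓ r (1≤ℓ , ℓ≤k , 1≤r , r≤len) = 1≤ℓ , ℓ≤k , start< , ≤end
    where
    start< : bd (ℓ ∸ 1) < bd (ℓ ∸ 1) + r
    start< = subst (_< bd (ℓ ∸ 1) + r) (+-identityʳ _) (+-monoʳ-< (bd (ℓ ∸ 1)) 1≤r)
    ≤end : bd (ℓ ∸ 1) + r ≤ bd ℓ
    ≤end = ≤-trans (+-monoʳ-≤ (bd (ℓ ∸ 1)) r≤len) (≤-reflexive (m+[n∸m]≡n (bd-pred≤ ℓ ℓ≤k)))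

  InSeq⇒Pos : ∀ ℓ i → InSeq ℓ i → Pos ℓ (i ∸ bd (ℓ ∸ 1)) × (binAt Q ℓ (i ∸ bd (ℓ ∸ 1)) ≡ i)
  InSeq⇒Pos ℓ i (1≤ℓ , ℓ≤k , start< , i≤end) =
    (1≤ℓ , ℓ≤k , m<n⇒0<n∸m start< , ∸-monoˡ-≤ (bd (ℓ ∸ 1)) i≤end) , m+[n∸m]≡n (<⇒≤ start<)

  posOf : ℕ → ℕ
  posOf i = i ∸ bd (seqOf i ∸ 1)

  locate : ∀ i → 1 ≤ i → i ≤ nBins Q → Pos (seqOf i) (posOf i) × (binAt Q (seqOf i) (posOf i) ≡ i)
  locate i 1≤i i≤n = InSeq⇒Pos (seqOf i) i (seqOf-spec i 1≤i i≤n)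

  binAt-injective : ∀ ℓ r ℓ' r' → Pos ℓ r → Pos ℓ' r' → binAt Q ℓ r ≡ binAt Q ℓ' r' → (ℓ ≡ ℓ') × (r ≡ r')
  binAt-injective ℓ r ℓ' r' pos pos' same
    with InSeq-unique ℓ ℓ' _ (Pos⇒InSeq ℓ r pos) (subst (InSeq ℓ') (sym same) (Pos⇒InSeq ℓ' r' pos'))
  ... | refl = refl , +-cancelˡ-≡ (bd (ℓ ∸ 1)) r r' same

  binAt-range : ∀ ℓ r → Pos ℓ r → (1 ≤ binAt Q ℓ r) × (binAt Q ℓ r ≤ nBins Q)
  binAt-range ℓ r pos with Pos⇒InSeq ℓ r pos
  ... | (_ , ℓ≤k , start< , ≤end) = ≤-trans (s≤s z≤n) start< , ≤-trans ≤end (bd-mono ℓ k ℓ≤k ≤-refl)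

  nBins≥1 : 1 ≤ k → 1 ≤ nBins Q
  nBins≥1 1≤k = subst (_< bd k) bd-0 (<-≤-trans (bd-< 0 1≤k) (bd-mono 1 k 1≤k ≤-refl))

  len≥1 : ∀ ℓ → 1 ≤ ℓ → ℓ ≤ k → 1 ≤ len Q ℓ
  len≥1 (suc ℓ) _ ℓ<k = m<n⇒0<n∸m (bd-< ℓ ℓ<k)

  -- With k ≥ 1 there are at least two bins (the pallet of bin 1 has two
  -- bins), so the range c ∈ [1, n-1] of the ILP's cut points is not empty.
  nBins≥2 : 1 ≤ k → 2 ≤ nBins Q
  nBins≥2 1≤k with plt-range 1 ≤-refl (nBins≥1 1≤k)
  ... | t≥1 , t≤m with two-bins (plt 1) t≥1 t≤m
  ...   | i , i' , i≢i' , 1≤i , i≤n , 1≤i' , i'≤n , _ with <-cmp i i'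
  ...     | tri< i<i' _ _ = ≤-trans (s≤s 1≤i) (≤-trans i<i' i'≤n)
  ...     | tri≈ _ i≡i' _ = ⊥-elim (i≢i' i≡i')
  ...     | tri> _ _ i'<i = ≤-trans (s≤s 1≤i') (≤-trans i'<i i≤n)

-- A list of steps is followed from a configuration; the
-- potential Σ_ℓ (|q_ℓ| - i_ℓ) (the number of bins not yet removed) drops by
-- one at each step and is 0 at the end, so every processing has exactly n
-- steps.  Bounding the search by the potential decides whether a processing
-- with at most p open pallets exists; one with p = m always does, so the
-- optimal p exists.
module Runs (Q : Instance) where
  open Instance Q
  open Layout Q

  configAfter : Config → List ℕ → ℕ → Config
  configAfter c js       zero    = c
  configAfter c []       (suc s) = c
  configAfter c (j ∷ js) (suc s) = configAfter (step Q c j) js s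

  step-here : ∀ c j → step Q c j j ≡ suc (c j)
  step-here c j rewrite to T-≡ (≡⇒≡ᵇ j j refl) = refl

  step-elsewhere : ∀ c j ℓ → ℓ ≢ j → step Q c j ℓ ≡ c ℓ
  step-elsewhere c j ℓ ℓ≢j with ℓ ≡ᵇ j in eq
  ... | true  = ⊥-elim (ℓ≢j (≡ᵇ⇒≡ ℓ j (from T-≡ eq)))
  ... | false = refl

  step-≥ : ∀ c j ℓ → c ℓ ≤ step Q c j ℓ
  step-≥ c j ℓ with ℓ ≡ᵇ j
  ... | true  = n≤1+n _
  ... | false = ≤-refl

  configAfter-suc : ∀ c js s ℓ → configAfter c js s ℓ ≤ configAfter c js (suc s) ℓ
  configAfter-suc c []       zero    ℓ = ≤-refl
  configAfter-suc c []       (suc s) ℓ = ≤-refl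
  configAfter-suc c (j ∷ js) zero    ℓ = step-≥ c j ℓ
  configAfter-suc c (j ∷ js) (suc s) ℓ = configAfter-suc (step Q c j) js s ℓ

  configAfter-mono : ∀ c js s s' ℓ → s ≤ s' → configAfter c js s ℓ ≤ configAfter c js s' ℓ
  configAfter-mono c js s zero     ℓ z≤n = ≤-refl
  configAfter-mono c js s (suc s') ℓ s≤ with s ≟ suc s'
  ... | yes refl = ≤-refl
  ... | no s≢    = ≤-trans (configAfter-mono c js s s' ℓ (≤-pred-≢ s≤ s≢)) (configAfter-suc c js s' ℓ)

  Final : Config → Set
  Final c = ∀ ℓ → 1 ≤ ℓ → ℓ ≤ k → c ℓ ≡ len Q ℓ

  InBounds : Config → Set
  InBounds c = ∀ ℓ → 1 ≤ ℓ → ℓ ≤ k → c ℓ ≤ len Q ℓ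

  step-InBounds : ∀ c j → InBounds c → c j < len Q j → InBounds (step Q c j)
  step-InBounds c j bounded j-open ℓ 1≤ℓ ℓ≤k with ℓ ≟ j
  ... | yes refl rewrite step-here c ℓ = j-open
  ... | no ℓ≢j   rewrite step-elsewhere c j ℓ ℓ≢j = bounded ℓ 1≤ℓ ℓ≤k

  run-open : ∀ p c js → RunBounded Q p c js → ∀ s → s ≤ length js → openCount Q (configAfter c js s) ≤ p
  run-open p c []       run                   zero    _       = proj₁ run
  run-open p c (j ∷ js) run                   zero    _       = proj₁ run
  run-open p c (j ∷ js) (_ , _ , _ , _ , run) (suc s) (s≤s s≤) = run-open p (step Q c j) js run s s≤

  run-step : ∀ p c js → RunBounded Q p c js → ∀ s → s < length js →
             Σ ℕ λ j → (1 ≤ j) × (j ≤ k) × (configAfter c js s j < len Q j)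
                     × (configAfter c js (suc s) ≡ step Q (configAfter c js s) j)
  run-step p c (j ∷ js) (_ , 1≤j , j≤k , j-open , run) zero    _        = j , 1≤j , j≤k , j-open , refl
  run-step p c (j ∷ js) (_ , _ , _ , _ , run)          (suc s) (s≤s s<) = run-step p (step Q c j) js run s s<

  run-final : ∀ p c js → RunBounded Q p c js → Final (configAfter c js (length js))
  run-final p c []       run                   = proj₂ run
  run-final p c (j ∷ js) (_ , _ , _ , _ , run) = run-final p (step Q c j) js run

  run-InBounds : ∀ p c js → RunBounded Q p c js → InBounds c → ∀ s → InBounds (configAfter c js s)
  run-InBounds p c js       run                        bounded zero    = bounded
  run-InBounds p c []       run                        bounded (suc s) = bounded
  run-InBounds p c (j ∷ js) (_ , _ , _ , j-open , run) bounded (suc s) =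
    run-InBounds p (step Q c j) js run (step-InBounds c j bounded j-open) s

  potential : Config → ℕ
  potential c = sumN k (λ ℓ → len Q ℓ ∸ c ℓ)

  partial-unchanged : ∀ c j K → K < j → sumN K (λ ℓ → len Q ℓ ∸ step Q c j ℓ) ≡ sumN K (λ ℓ → len Q ℓ ∸ c ℓ)
  partial-unchanged c j K K<j =
    sumN-cong K _ _ λ ℓ _ ℓ≤K → cong (len Q ℓ ∸_) (step-elsewhere c j ℓ λ ℓ≡j → <⇒≱ K<j (subst (_≤ K) ℓ≡j ℓ≤K))

  partial-drops : ∀ c j K → 1 ≤ j → j ≤ K → c j < len Q j →
                  suc (sumN K (λ ℓ → len Q ℓ ∸ step Q c j ℓ)) ≡ sumN K (λ ℓ → len Q ℓ ∸ c ℓ)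
  partial-drops c j zero    1≤j j≤0 j-open = ⊥-elim (<⇒≱ 1≤j j≤0)
  partial-drops c j (suc K) 1≤j j≤ j-open with j ≟ suc K
  ... | yes refl rewrite partial-unchanged c j K ≤-refl | step-here c j =
    trans (sym (+-suc _ _)) (cong (λ z → sumN K (λ ℓ → len Q ℓ ∸ c ℓ) + z) (sym (+-∸-assoc 1 j-open)))
  ... | no j≢ rewrite step-elsewhere c j (suc K) (λ e → j≢ (sym e)) =
    cong (_+ (len Q (suc K) ∸ c (suc K))) (partial-drops c j K 1≤j (≤-pred-≢ j≤ j≢) j-open)

  potential-step : ∀ c j → 1 ≤ j → j ≤ k → c j < len Q j → suc (potential (step Q c j)) ≡ potential c
  potential-step c j 1≤j j≤k = partial-drops c j k 1≤j j≤k

  potential-final : ∀ c → Final c → potential c ≡ 0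
  potential-final c final = sumN-zero k _ λ ℓ 1≤ℓ ℓ≤k → subst (λ z → len Q ℓ ∸ z ≡ 0) (sym (final ℓ 1≤ℓ ℓ≤k)) (n∸n≡0 (len Q ℓ))

  potential-initial : potential (initial Q) ≡ nBins Q
  potential-initial = upTo k ≤-refl
    where
    upTo : ∀ K → K ≤ k → sumN K (λ ℓ → len Q ℓ ∸ 0) ≡ bd K
    upTo zero    _   = sym bd-0
    upTo (suc K) K<k rewrite upTo K (<⇒≤ K<k) = m+[n∸m]≡n (<⇒≤ (bd-< K K<k))

  run-length : ∀ p c js → RunBounded Q p c js → length js ≡ potential c
  run-length p c []       run                        = sym (potential-final c (proj₂ run))
  run-length p c (j ∷ js) (_ , 1≤j , j≤k , j-open , run) =
    trans (cong suc (run-length p (step Q c j) js run)) (potential-step c j 1≤j j≤k j-open)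

  ProcessableFrom : ℕ → Config → Set
  ProcessableFrom p c = Σ (List ℕ) λ js → RunBounded Q p c js

  Final? : ∀ c → Dec (Final c)
  Final? c = all?-upTo k (λ ℓ → c ℓ ≡ len Q ℓ) (λ ℓ → c ℓ ≟ len Q ℓ)

  Continuation : ℕ → Config → ℕ → Set
  Continuation p c j = (1 ≤ j) × (j ≤ k) × (c j < len Q j) × ProcessableFrom p (step Q c j)

  ProcessableFrom?-step : ∀ p c → (∀ j → 1 ≤ j → j ≤ k → c j < len Q j → Dec (ProcessableFrom p (step Q c j))) →
                          Dec (ProcessableFrom p c)
  ProcessableFrom?-step p c next? with openCount Q c ≤? p
  ... | no too-many = no λ { ([] , run) → too-many (proj₁ run) ; (_ ∷ _ , run) → too-many (proj₁ run) }
  ... | yes bounded with Final? c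
  ...   | yes final = yes ([] , bounded , final)
  ...   | no ¬final with any?-upTo k (Continuation p c) continuation?
    where
    continuation? : ∀ j → Dec (Continuation p c j)
    continuation? j with 1 ≤? j | j ≤? k | c j <? len Q j
    ... | no ¬1≤j | _       | _        = no λ cont → ¬1≤j (proj₁ cont)
    ... | yes _   | no ¬j≤k | _        = no λ cont → ¬j≤k (proj₁ (proj₂ cont))
    ... | yes _   | yes _   | no ¬open = no λ cont → ¬open (proj₁ (proj₂ (proj₂ cont)))
    ... | yes 1≤j | yes j≤k | yes j-open with next? j 1≤j j≤k j-open
    ...   | yes ok = yes (1≤j , j≤k , j-open , ok)
    ...   | no ¬ok = no λ cont → ¬ok (proj₂ (proj₂ (proj₂ cont)))
  ...     | yes (j , _ , _ , 1≤j , j≤k , j-open , js , run) = yes (j ∷ js , bounded , 1≤j , j≤k , j-open , run)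
  ...     | no ¬continue = no λ { ([] , run) → ¬final (proj₂ run)
                                ; (j ∷ js , (_ , 1≤j , j≤k , j-open , run)) → ¬continue (j , 1≤j , j≤k , 1≤j , j≤k , j-open , js , run) }

  -- the search terminates since the potential decreases
  ProcessableFrom? : ∀ N p c → potential c ≡ N → Dec (ProcessableFrom p c)
  ProcessableFrom? zero    p c pot≡ = ProcessableFrom?-step p c λ j 1≤j j≤k j-open →
    ⊥-elim (1+n≢0 (trans (potential-step c j 1≤j j≤k j-open) pot≡))
  ProcessableFrom? (suc N) p c pot≡ = ProcessableFrom?-step p c λ j 1≤j j≤k j-open →
    ProcessableFrom? N p (step Q c j) (suc-injective (trans (potential-step c j 1≤j j≤k j-open) pot≡))

  processable-with-m : ∀ N c → potential c ≡ N → InBounds c → ProcessableFrom m c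
  processable-with-m N c pot≡ bounded with Final? c | any?-upTo k (λ j → c j < len Q j) (λ j → c j <? len Q j)
  ... | yes final | _ = [] , countUpTo-≤ m (isOpen Q c) , final
  ... | no ¬final | no ¬open = ⊥-elim (¬final λ ℓ 1≤ℓ ℓ≤k → ≤-antisym (bounded ℓ 1≤ℓ ℓ≤k) (≮⇒≥ λ ℓ-open → ¬open (ℓ , 1≤ℓ , ℓ≤k , ℓ-open)))
  ... | no ¬final | yes (j , 1≤j , j≤k , j-open) with N
  ...   | zero  = ⊥-elim (1+n≢0 (trans (potential-step c j 1≤j j≤k j-open) pot≡))
  ...   | suc N′ =
    let (js , run) = processable-with-m N′ (step Q c j) (suc-injective (trans (potential-step c j 1≤j j≤k j-open) pot≡))
                                        (step-InBounds c j bounded j-open)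
    in j ∷ js , countUpTo-≤ m (isOpen Q c) , 1≤j , j≤k , j-open , run

  optimal-processing : Σ ℕ λ v → IsMinProcessing Q v
  optimal-processing = least-witness (ProcessableWith Q) (λ p → ProcessableFrom? _ p (initial Q) refl) m
                         (processable-with-m _ (initial Q) refl (λ _ _ _ → z≤n))

-- From a processing with at most p open pallets to a feasible assignment with
-- objective value p.  With C s the configuration after s steps:
--   x_i^s  = bin i is removed by the s-th step,
--   g(t,c) = some bin of pallet t has been removed in C c,
--   h(t,c) = some bin of pallet t is still present in C c,
--   f(t,c) = pallet t is open in C c, which by definition of isOpen is g ∧ h.
-- Rows of x sum to 1 because "removed" switches on once, columns because each
-- step removes one bin, and (2) holds because removed bins form prefixes.
module RunToAssignment (Q : Instance) (p : ℕ) (js : List ℕ) (run : RunBounded Q p (initial Q) js) where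
  open Instance Q
  open Layout Q
  open Runs Q

  n : ℕ
  n = nBins Q

  C : ℕ → Config
  C = configAfter (initial Q) js

  steps≡n : length js ≡ n
  steps≡n = trans (run-length p _ js run) potential-initial

  C-InBounds : ∀ s → InBounds (C s)
  C-InBounds = run-InBounds p _ js run (λ _ _ _ → z≤n)

  C-final : Final (C n)
  C-final = subst (λ s → Final (C s)) steps≡n (run-final p _ js run)

  Removed : Config → ℕ → Set
  Removed c i = Σ ℕ λ ℓ → Σ ℕ λ r → (1 ≤ ℓ) × (ℓ ≤ k) × (1 ≤ r) × (r ≤ c ℓ) × (binAt Q ℓ r ≡ i)

  removed? : Config → ℕ → Bool
  removed? c i = anyIn 1 k (λ ℓ → anyIn 1 (c ℓ) (λ r → binAt Q ℓ r ≡ᵇ i))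

  removed?-intro : ∀ c i → Removed c i → T (removed? c i)
  removed?-intro c i (ℓ , r , 1≤ℓ , ℓ≤k , 1≤r , r≤ , bin≡) =
    anyIn-intro 1 k _ ℓ ≤-refl 1≤ℓ ℓ≤k (anyIn-intro 1 (c ℓ) _ r ≤-refl 1≤r r≤ (≡⇒≡ᵇ _ _ bin≡))

  removed?-elim : ∀ c i → T (removed? c i) → Removed c i
  removed?-elim c i rem with anyIn-elim 1 k _ rem
  ... | ℓ , 1≤ℓ , ℓ≤k , remℓ with anyIn-elim 1 (c ℓ) _ remℓ
  ...   | r , 1≤r , r≤ , bin≡ = ℓ , r , 1≤ℓ , ℓ≤k , 1≤r , r≤ , ≡ᵇ⇒≡ _ _ bin≡

  Removed-mono : ∀ c c' i → (∀ ℓ → c ℓ ≤ c' ℓ) → Removed c i → Removed c' i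
  Removed-mono c c' i c≤c' (ℓ , r , 1≤ℓ , ℓ≤k , 1≤r , r≤ , bin≡) = ℓ , r , 1≤ℓ , ℓ≤k , 1≤r , ≤-trans r≤ (c≤c' ℓ) , bin≡

  Removed-prefix : ∀ c → InBounds c → ∀ ℓ i i' → 1 ≤ ℓ → ℓ ≤ k → suc (bd (ℓ ∸ 1)) ≤ i → i < i' → i' ≤ bd ℓ →
                   Removed c i' → Removed c i
  Removed-prefix c bounded ℓ i i' 1≤ℓ ℓ≤k start< i<i' i'≤end (ℓ' , r' , 1≤ℓ' , ℓ'≤k , 1≤r' , r'≤ , bin≡)
    with InSeq-unique ℓ' ℓ i' (subst (InSeq ℓ') bin≡ (Pos⇒InSeq ℓ' r' (1≤ℓ' , ℓ'≤k , 1≤r' , ≤-trans r'≤ (bounded ℓ' 1≤ℓ' ℓ'≤k))))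
                      (1≤ℓ , ℓ≤k , <-trans start< i<i' , i'≤end)
  ... | refl with InSeq⇒Pos ℓ i (1≤ℓ , ℓ≤k , start< , ≤-trans (<⇒≤ i<i') i'≤end)
  ...   | (_ , _ , 1≤r , _) , bin≡′ = ℓ , i ∸ bd (ℓ ∸ 1) , 1≤ℓ , ℓ≤k , 1≤r , ≤-trans (<⇒≤ r<r') r'≤ , bin≡′
    where
    r<r' : i ∸ bd (ℓ ∸ 1) < r'
    r<r' = +-cancelˡ-< (bd (ℓ ∸ 1)) (i ∸ bd (ℓ ∸ 1)) r' (subst₂ _<_ (sym bin≡′) (sym bin≡) i<i')

  next : Config → ℕ → ℕ
  next c j = binAt Q j (suc (c j))

  next-Removed : ∀ c j → 1 ≤ j → j ≤ k → Removed (step Q c j) (next c j)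
  next-Removed c j 1≤j j≤k = j , suc (c j) , 1≤j , j≤k , s≤s z≤n , ≤-reflexive (sym (step-here c j)) , refl

  next-¬Removed : ∀ c j → InBounds c → 1 ≤ j → j ≤ k → c j < len Q j → ¬ Removed c (next c j)
  next-¬Removed c j bounded 1≤j j≤k j-open (ℓ , r , 1≤ℓ , ℓ≤k , 1≤r , r≤ , bin≡)
    with binAt-injective ℓ r j (suc (c j)) (1≤ℓ , ℓ≤k , 1≤r , ≤-trans r≤ (bounded ℓ 1≤ℓ ℓ≤k)) (1≤j , j≤k , s≤s z≤n , j-open) bin≡
  ... | refl , refl = 1+n≰n r≤

  Removed-step : ∀ c j i → Removed (step Q c j) i → Removed c i ⊎ (i ≡ next c j)
  Removed-step c j i (ℓ , r , 1≤ℓ , ℓ≤k , 1≤r , r≤ , bin≡) with ℓ ≟ j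
  ... | no ℓ≢j = inj₁ (ℓ , r , 1≤ℓ , ℓ≤k , 1≤r , subst (r ≤_) (step-elsewhere c j ℓ ℓ≢j) r≤ , bin≡)
  ... | yes refl with r ≟ suc (c ℓ)
  ...   | yes refl = inj₂ (sym bin≡)
  ...   | no r≢    = inj₁ (ℓ , r , 1≤ℓ , ℓ≤k , 1≤r , ≤-pred-≢ (subst (r ≤_) (step-here c ℓ) r≤) r≢ , bin≡)

  newly-removed : ∀ c j → InBounds c → 1 ≤ j → j ≤ k → c j < len Q j → ∀ i →
                  (removed? (step Q c j) i ∧ not (removed? c i)) ≡ (i ≡ᵇ next c j)
  newly-removed c j bounded 1≤j j≤k j-open i = T-ext is-next becomes-removed
    where
    is-next : T (removed? (step Q c j) i ∧ not (removed? c i)) → T (i ≡ᵇ next c j)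
    is-next new with to T-∧ new
    ... | now , ¬before with Removed-step c j i (removed?-elim _ i now)
    ...   | inj₁ before = ⊥-elim (T-not⇒¬T ¬before (removed?-intro c i before))
    ...   | inj₂ i≡next = ≡⇒≡ᵇ _ _ i≡next
    becomes-removed : T (i ≡ᵇ next c j) → T (removed? (step Q c j) i ∧ not (removed? c i))
    becomes-removed i≡next with ≡ᵇ⇒≡ i (next c j) i≡next
    ... | refl = from T-∧ ( removed?-intro _ _ (next-Removed c j 1≤j j≤k)
                          , ¬T⇒T-not λ before → next-¬Removed c j bounded 1≤j j≤k j-open (removed?-elim c _ before))

  removedAt : ℕ → ℕ → Bool
  removedAt s i = removed? (C s) i

  removedAt-mono : ∀ i s s' → s ≤ s' → T (removedAt s i) → T (removedAt s' i)
  removedAt-mono i s s' s≤s' rem =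
    removed?-intro (C s') i (Removed-mono (C s) (C s') i (λ ℓ → configAfter-mono _ js s s' ℓ s≤s') (removed?-elim (C s) i rem))

  removedAt-initial : ∀ i → removedAt 0 i ≡ false
  removedAt-initial i = ¬T⇒≡false λ rem → let (_ , _ , _ , _ , 1≤r , r≤0 , _) = removed?-elim (initial Q) i rem in <⇒≱ 1≤r r≤0

  removedAt-final : ∀ i → 1 ≤ i → i ≤ n → T (removedAt n i)
  removedAt-final i 1≤i i≤n with locate i 1≤i i≤n
  ... | (1≤ℓ , ℓ≤k , 1≤r , r≤len) , bin≡ =
    removed?-intro (C n) i (seqOf i , posOf i , 1≤ℓ , ℓ≤k , 1≤r , subst (posOf i ≤_) (sym (C-final _ 1≤ℓ ℓ≤k)) r≤len , bin≡)

  removedBy : ℕ → ℕ → Bool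
  removedBy i s = switchOn (λ s → removedAt s i) s

  row-sum : ∀ i → 1 ≤ i → i ≤ n → sumN n (λ s → ind (removedBy i s)) ≡ 1
  row-sum i 1≤i i≤n rewrite telescope (λ s → removedAt s i) (removedAt-initial i) (λ s → removedAt-mono i s (suc s) (n≤1+n s)) n
                           | to T-≡ (removedAt-final i 1≤i i≤n) = refl

  column-sum : ∀ s → 1 ≤ s → s ≤ n → sumN n (λ i → ind (removedBy i s)) ≡ 1
  column-sum (suc s) _ s<n with run-step p _ js run s (subst (suc s ≤_) (sym steps≡n) s<n)
  ... | j , 1≤j , j≤k , j-open , C≡step = begin
    sumN n (λ i → ind (removedBy i (suc s)))   ≡⟨ sumN-cong n _ _ (λ i _ _ → cong ind (removed-by-step i)) ⟩
    sumN n (λ i → ind (i ≡ᵇ next (C s) j))     ≡⟨ sumN-point n _ 1≤next next≤n ⟩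
    1                                          ∎
    where
    open ≡-Reasoning
    removed-by-step : ∀ i → removedBy i (suc s) ≡ (i ≡ᵇ next (C s) j)
    removed-by-step i = trans (cong (λ c → removed? c i ∧ not (removedAt s i)) C≡step)
                              (newly-removed (C s) j (C-InBounds s) 1≤j j≤k j-open i)
    1≤next = proj₁ (binAt-range j _ (1≤j , j≤k , s≤s z≤n , j-open))
    next≤n = proj₂ (binAt-range j _ (1≤j , j≤k , s≤s z≤n , j-open))

  removal-order : ∀ ℓ i i' j j' → 1 ≤ ℓ → ℓ ≤ k → suc (bd (ℓ ∸ 1)) ≤ i → i < i' → i' ≤ bd ℓ →
                  T (removedBy i' j') → T (removedBy i j) → ¬ (j' < j)
  removal-order ℓ i i' j j' 1≤ℓ ℓ≤k start< i<i' i'≤end by-i' by-i j'<j =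
    T-not⇒¬T (proj₂ (to T-∧ by-i))
      (removed?-intro (C (j ∸ 1)) i (Removed-prefix (C (j ∸ 1)) (C-InBounds (j ∸ 1)) ℓ i i' 1≤ℓ ℓ≤k start< i<i' i'≤end
        (removed?-elim (C (j ∸ 1)) i' (removedAt-mono i' j' (j ∸ 1) (suc[m]≤n⇒m≤pred[n] j'<j) (proj₁ (to T-∧ by-i'))))))

  someRemoved : ℕ → ℕ → Bool
  someRemoved c t = anyIn 1 k (λ j → anyIn 1 (C c j) (λ r → plt (binAt Q j r) ≡ᵇ t))

  someLeft : ℕ → ℕ → Bool
  someLeft c t = anyIn 1 k (λ ℓ → anyIn (suc (C c ℓ)) (len Q ℓ) (λ r → plt (binAt Q ℓ r) ≡ᵇ t))

  someRemoved-intro : ∀ c t i → Removed (C c) i → plt i ≡ t → T (someRemoved c t)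
  someRemoved-intro c t i (ℓ , r , 1≤ℓ , ℓ≤k , 1≤r , r≤ , bin≡) plt≡ =
    anyIn-intro 1 k _ ℓ ≤-refl 1≤ℓ ℓ≤k (anyIn-intro 1 (C c ℓ) _ r ≤-refl 1≤r r≤ (≡⇒≡ᵇ _ _ (trans (cong plt bin≡) plt≡)))

  someRemoved-elim : ∀ c t → T (someRemoved c t) → Σ ℕ λ i → (1 ≤ i) × (i ≤ n) × (plt i ≡ t) × Removed (C c) i
  someRemoved-elim c t some with anyIn-elim 1 k _ some
  ... | ℓ , 1≤ℓ , ℓ≤k , someℓ with anyIn-elim 1 (C c ℓ) _ someℓ
  ...   | r , 1≤r , r≤ , plt≡ =
    let pos = (1≤ℓ , ℓ≤k , 1≤r , ≤-trans r≤ (C-InBounds c ℓ 1≤ℓ ℓ≤k))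
        (1≤i , i≤n) = binAt-range ℓ r pos
    in binAt Q ℓ r , 1≤i , i≤n , ≡ᵇ⇒≡ _ _ plt≡ , (ℓ , r , 1≤ℓ , ℓ≤k , 1≤r , r≤ , refl)

  someLeft-intro : ∀ c t i → 1 ≤ i → i ≤ n → ¬ Removed (C c) i → plt i ≡ t → T (someLeft c t)
  someLeft-intro c t i 1≤i i≤n ¬removed plt≡ with locate i 1≤i i≤n
  ... | (1≤ℓ , ℓ≤k , 1≤r , r≤len) , bin≡ =
    anyIn-intro 1 k _ (seqOf i) ≤-refl 1≤ℓ ℓ≤k
      (anyIn-intro (suc (C c (seqOf i))) (len Q (seqOf i)) _ (posOf i) (s≤s z≤n) present r≤len
        (≡⇒≡ᵇ _ _ (trans (cong plt bin≡) plt≡)))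
    where
    present : C c (seqOf i) < posOf i
    present = ≰⇒> λ r≤ → ¬removed (seqOf i , posOf i , 1≤ℓ , ℓ≤k , 1≤r , r≤ , bin≡)

  someLeft-elim : ∀ c t → T (someLeft c t) → Σ ℕ λ i → (1 ≤ i) × (i ≤ n) × (plt i ≡ t) × ¬ Removed (C c) i
  someLeft-elim c t some with anyIn-elim 1 k _ some
  ... | ℓ , 1≤ℓ , ℓ≤k , someℓ with anyIn-elim (suc (C c ℓ)) (len Q ℓ) _ someℓ
  ...   | r , present , r≤len , plt≡ =
    let pos = (1≤ℓ , ℓ≤k , ≤-trans (s≤s z≤n) present , r≤len)
        (1≤i , i≤n) = binAt-range ℓ r pos
    in binAt Q ℓ r , 1≤i , i≤n , ≡ᵇ⇒≡ _ _ plt≡ , not-removed pos present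
    where
    not-removed : Pos ℓ r → C c ℓ < r → ¬ Removed (C c) (binAt Q ℓ r)
    not-removed pos present (ℓ' , r' , 1≤ℓ' , ℓ'≤k , 1≤r' , r'≤ , bin≡)
      with binAt-injective ℓ' r' ℓ r (1≤ℓ' , ℓ'≤k , 1≤r' , ≤-trans r'≤ (C-InBounds c ℓ' 1≤ℓ' ℓ'≤k)) pos bin≡
    ... | refl , refl = 1+n≰n (≤-trans present r'≤)

  double-sum-positive : ∀ t (S : ℕ → Bool) i j → 1 ≤ i → i ≤ n → plt i ≡ t → 1 ≤ j → j ≤ n → T (S j) →
                        T (removedBy i j) →
                        1 ≤ sumN n (λ i → if plt i ≡ᵇ t then sumN n (λ j → if S j then ind (removedBy i j) else 0) else 0)
  double-sum-positive t S i j 1≤i i≤n plt≡ 1≤j j≤n Sj by =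
    ≤-trans (≤-reflexive (sym (ind-T by)))
      (≤-trans (filtered-term≤sumN n S (λ j → ind (removedBy i j)) j 1≤j j≤n Sj)
               (filtered-term≤sumN n (λ i → plt i ≡ᵇ t) _ i 1≤i i≤n (≡⇒≡ᵇ _ _ plt≡)))

  assignment : Assignment
  assignment = record
    { x = λ i j → + ind (removedBy i j)
    ; p = + p
    ; g = λ t c → + ind (someRemoved c t)
    ; h = λ t c → + ind (someLeft c t)
    ; f = λ t c → + ind (isOpen Q (C c) t)
    }

  capacity : ∀ c → (1 ≤ c) × (c ≤ n ∸ 1) → sumTo m (λ t → + ind (isOpen Q (C c) t)) ℤ.≤ + p
  capacity c (_ , c≤) = subst (ℤ._≤ + p) (sym (sumTo-+ m (λ t → ind (isOpen Q (C c) t))))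
    (ℤ.+≤+ (subst (_≤ p) (countUpTo-sum m (isOpen Q (C c)))
      (run-open p _ js run c (subst (c ≤_) (sym steps≡n) (≤-trans c≤ (m∸n≤m n 1))))))

  g-bound : ∀ t c i j → (1 ≤ t) × (t ≤ m) → (1 ≤ c) × (c ≤ n ∸ 1) → (1 ≤ i) × (i ≤ n) → plt i ≡ t →
            (1 ≤ j) × (j ≤ n) → j ≤ c → + ind (removedBy i j) ℤ.- + ind (someRemoved c t) ℤ.≤ + 0
  g-bound t c i j _ _ _ plt≡ _ j≤c = ind-implies (removedBy i j) (someRemoved c t) λ by →
    someRemoved-intro c t i (removed?-elim (C c) i (removedAt-mono i j c j≤c (proj₁ (to T-∧ by)))) plt≡

  g-covered : ∀ t c → (1 ≤ t) × (t ≤ m) → (1 ≤ c) × (c ≤ n ∸ 1) →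
              + 0 ℤ.≤ sumTo n (λ i → if plt i ≡ᵇ t then sumTo n (λ j → if j ≤ᵇ c then + ind (removedBy i j) else + 0) else + 0)
                      ℤ.- + ind (someRemoved c t)
  g-covered t c _ (_ , c≤) rewrite sumTo-filtered² n (λ i → plt i ≡ᵇ t) (λ i j → j ≤ᵇ c) (λ i j → ind (removedBy i j)) =
    ind-covered _ (someRemoved c t) λ some →
      let (i , 1≤i , i≤n , plt≡ , removed) = someRemoved-elim c t some
          (j , 0<j , j≤c , by) = switchOn-between (λ s → removedAt s i) 0 c (λ r → subst T (removedAt-initial i) r)
                                   (removed?-intro (C c) i removed) z≤n
      in double-sum-positive t (_≤ᵇ c) i j 1≤i i≤n plt≡ 0<j (≤-trans j≤c (≤-trans c≤ (m∸n≤m n 1))) (≤⇒≤ᵇ j≤c) by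

  h-bound : ∀ t c i j → (1 ≤ t) × (t ≤ m) → (1 ≤ c) × (c ≤ n ∸ 1) → (1 ≤ i) × (i ≤ n) → plt i ≡ t →
            (1 ≤ j) × (j ≤ n) → c < j → + ind (removedBy i j) ℤ.- + ind (someLeft c t) ℤ.≤ + 0
  h-bound t c i j _ _ (1≤i , i≤n) plt≡ _ c<j = ind-implies (removedBy i j) (someLeft c t) λ by →
    someLeft-intro c t i 1≤i i≤n
      (λ removed → T-not⇒¬T (proj₂ (to T-∧ by))
                     (removedAt-mono i c (j ∸ 1) (suc[m]≤n⇒m≤pred[n] c<j) (removed?-intro (C c) i removed)))
      plt≡

  h-covered : ∀ t c → (1 ≤ t) × (t ≤ m) → (1 ≤ c) × (c ≤ n ∸ 1) →
              + 0 ℤ.≤ sumTo n (λ i → if plt i ≡ᵇ t then sumTo n (λ j → if c <ᵇ j then + ind (removedBy i j) else + 0) else + 0)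
                      ℤ.- + ind (someLeft c t)
  h-covered t c _ (_ , c≤) rewrite sumTo-filtered² n (λ i → plt i ≡ᵇ t) (λ i j → c <ᵇ j) (λ i j → ind (removedBy i j)) =
    ind-covered _ (someLeft c t) λ some →
      let (i , 1≤i , i≤n , plt≡ , ¬removed) = someLeft-elim c t some
          (j , c<j , j≤n , by) = switchOn-between (λ s → removedAt s i) c n (λ r → ¬removed (removed?-elim (C c) i r))
                                   (removedAt-final i 1≤i i≤n) (≤-trans c≤ (m∸n≤m n 1))
      in double-sum-positive t (c <ᵇ_) i j 1≤i i≤n plt≡ (≤-trans (s≤s z≤n) c<j) j≤n (<⇒<ᵇ c<j) by

  feasible : Feasible Q assignment
  feasible = (λ i j _ _ → ind-binary (removedBy i j))
           , (λ t c _ _ → ind-binary (someRemoved c t) , ind-binary (someLeft c t) , ind-binary (isOpen Q (C c) t))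
           , (λ i (1≤i , i≤n) → trans (sumTo-+ n (λ j → ind (removedBy i j))) (cong +_ (row-sum i 1≤i i≤n)))
           , (λ j (1≤j , j≤n) → trans (sumTo-+ n (λ i → ind (removedBy i j))) (cong +_ (column-sum j 1≤j j≤n)))
           , (λ ℓ i i' j j' (1≤ℓ , ℓ≤k) start< i<i' i'≤end _ _ j'<j →
                ind-exclusive (removedBy i' j') (removedBy i j) λ by-i' by-i →
                  removal-order ℓ i i' j j' 1≤ℓ ℓ≤k start< i<i' i'≤end by-i' by-i j'<j)
           , (λ ℓ i i' j j' (1≤ℓ , ℓ≤k) start< i'<i i≤end _ _ j<j' →
                ind-exclusive (removedBy i' j') (removedBy i j) λ by-i' by-i →
                  removal-order ℓ i' i j' j 1≤ℓ ℓ≤k start< i'<i i≤end by-i by-i' j<j')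
           , capacity
           , g-bound , g-covered , h-bound , h-covered
           , (λ t c _ _ → ind-implies (someRemoved c t ∧ someLeft c t) (someRemoved c t) (λ open′ → proj₁ (to T-∧ open′))
                        , ind-implies (someRemoved c t ∧ someLeft c t) (someLeft c t) (λ open′ → proj₂ (to T-∧ open′))
                        , ind-∧ (someRemoved c t) (someLeft c t))

-- By (1), x is a permutation matrix: bin i is removed at
-- time `time i`, and `binAtTime s` is the bin removed at time s.  The
-- processing performs, at step s, a removal from the sequence containing
-- binAtTime s.  By induction on s, the configuration after s steps has
-- removed exactly the bins of time ≤ s; the inductive step uses (2), which
-- forbids binAtTime (s+1) to have a not yet removed predecessor.  A pallet
-- open after c steps then has g(t,c) = h(t,c) = 1 by (4) and (5), hence
-- f(t,c) = 1 by (6), and (3) bounds the number of open pallets by p.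
module AssignmentToRun (Q : Instance) (A : Assignment) where
  open Instance Q
  open Assignment A
  open Layout Q
  open Runs Q

  n : ℕ
  n = nBins Q

  time : ℕ → ℕ
  time i = UniqueOne.one n (λ s → x i s)

  binAtTime : ℕ → ℕ
  binAtTime s = UniqueOne.one n (λ i → x i s)

  seqAtTime : ℕ → ℕ
  seqAtTime s = seqOf (binAtTime s)

  C : ℕ → Config
  C zero    = initial Q
  C (suc s) = step Q (C s) (seqAtTime (suc s))

  steps : ℕ → ℕ → List ℕ
  steps s zero    = []
  steps s (suc r) = seqAtTime s ∷ steps (suc s) r

  module Reconstruction
    (1≤k : 1 ≤ k)
    (x-binary : ∀ i j → (1 ≤ i) × (i ≤ n) → (1 ≤ j) × (j ≤ n) → Binary (x i j))
    (ghf-binary : ∀ t c → (1 ≤ t) × (t ≤ m) → (1 ≤ c) × (c ≤ n ∸ 1) → Binary (g t c) × Binary (h t c) × Binary (f t c))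
    (row-one : ∀ i → (1 ≤ i) × (i ≤ n) → sumTo n (λ j → x i j) ≡ + 1)
    (column-one : ∀ j → (1 ≤ j) × (j ≤ n) → sumTo n (λ i → x i j) ≡ + 1)
    (in-order : ∀ ℓ i i' j j' → (1 ≤ ℓ) × (ℓ ≤ k) → suc (bd (ℓ ∸ 1)) ≤ i → i < i' → i' ≤ bd ℓ →
                (1 ≤ j) × (j ≤ n) → (1 ≤ j') × (j' ≤ n) → j' < j → x i' j' ℤ.≤ + 1 ℤ.- x i j)
    (capacity : ∀ c → (1 ≤ c) × (c ≤ n ∸ 1) → sumTo m (λ t → f t c) ℤ.≤ p)
    (g-bound : ∀ t c i j → (1 ≤ t) × (t ≤ m) → (1 ≤ c) × (c ≤ n ∸ 1) → (1 ≤ i) × (i ≤ n) → plt i ≡ t →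
               (1 ≤ j) × (j ≤ n) → j ≤ c → x i j ℤ.- g t c ℤ.≤ + 0)
    (h-bound : ∀ t c i j → (1 ≤ t) × (t ≤ m) → (1 ≤ c) × (c ≤ n ∸ 1) → (1 ≤ i) × (i ≤ n) → plt i ≡ t →
               (1 ≤ j) × (j ≤ n) → c < j → x i j ℤ.- h t c ℤ.≤ + 0)
    (f-link : ∀ t c → (1 ≤ t) × (t ≤ m) → (1 ≤ c) × (c ≤ n ∸ 1) → g t c ℤ.+ h t c ℤ.- f t c ℤ.≤ + 1)
    where

    time-spec : ∀ i → 1 ≤ i → i ≤ n → (1 ≤ time i) × (time i ≤ n) × (x i (time i) ≡ + 1)
    time-spec i 1≤i i≤n =
      UniqueOne.one-spec n (λ s → x i s) (λ s 1≤s s≤n → x-binary i s (1≤i , i≤n) (1≤s , s≤n)) (row-one i (1≤i , i≤n))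

    binAtTime-spec : ∀ s → 1 ≤ s → s ≤ n → (1 ≤ binAtTime s) × (binAtTime s ≤ n) × (x (binAtTime s) s ≡ + 1)
    binAtTime-spec s 1≤s s≤n =
      UniqueOne.one-spec n (λ i → x i s) (λ i 1≤i i≤n → x-binary i s (1≤i , i≤n) (1≤s , s≤n)) (column-one s (1≤s , s≤n))

    binAtTime-unique : ∀ i s → 1 ≤ i → i ≤ n → 1 ≤ s → s ≤ n → x i s ≡ + 1 → i ≡ binAtTime s
    binAtTime-unique i s 1≤i i≤n 1≤s s≤n =
      UniqueOne.one-unique n (λ i → x i s) (λ i 1≤i i≤n → x-binary i s (1≤i , i≤n) (1≤s , s≤n)) (column-one s (1≤s , s≤n)) i 1≤i i≤n

    time-binAtTime : ∀ s → 1 ≤ s → s ≤ n → time (binAtTime s) ≡ s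
    time-binAtTime s 1≤s s≤n with binAtTime-spec s 1≤s s≤n
    ... | 1≤i , i≤n , x≡1 =
      sym (UniqueOne.one-unique n (λ s' → x (binAtTime s) s') (λ s' 1≤s' s'≤n → x-binary _ s' (1≤i , i≤n) (1≤s' , s'≤n))
                                (row-one _ (1≤i , i≤n)) s 1≤s s≤n x≡1)

    time-at : ∀ ℓ r → Pos ℓ r → (1 ≤ time (binAt Q ℓ r)) × (time (binAt Q ℓ r) ≤ n) × (x (binAt Q ℓ r) (time (binAt Q ℓ r)) ≡ + 1)
    time-at ℓ r pos = let (1≤i , i≤n) = binAt-range ℓ r pos in time-spec _ 1≤i i≤n

    time⇒binAtTime : ∀ ℓ r s → Pos ℓ r → 1 ≤ s → s ≤ n → time (binAt Q ℓ r) ≡ s → binAt Q ℓ r ≡ binAtTime s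
    time⇒binAtTime ℓ r s pos 1≤s s≤n time≡ with binAt-range ℓ r pos
    ... | 1≤i , i≤n = binAtTime-unique _ s 1≤i i≤n 1≤s s≤n (subst (λ s → x (binAt Q ℓ r) s ≡ + 1) time≡ (proj₂ (proj₂ (time-spec _ 1≤i i≤n))))

    RemovedExactly : ℕ → Set
    RemovedExactly s = InBounds (C s) ×
      (∀ ℓ r → Pos ℓ r → (r ≤ C s ℓ → time (binAt Q ℓ r) ≤ s) × (time (binAt Q ℓ r) ≤ s → r ≤ C s ℓ))

    -- If the invariant holds after s < n steps, the bin of time s+1 is the
    -- first bin of its sequence not yet removed.
    module NextBin (s : ℕ) (s<n : s < n) (inv : RemovedExactly s) where

      i₀ : ℕ
      i₀ = binAtTime (suc s)

      j : ℕ
      j = seqAtTime (suc s)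

      i₀-spec : (1 ≤ i₀) × (i₀ ≤ n) × (x i₀ (suc s) ≡ + 1)
      i₀-spec = binAtTime-spec (suc s) (s≤s z≤n) s<n

      i₀-located : Pos j (posOf i₀) × (binAt Q j (posOf i₀) ≡ i₀)
      i₀-located = locate i₀ (proj₁ i₀-spec) (proj₁ (proj₂ i₀-spec))

      -- i₀ is not yet removed: its time is s+1
      i₀-present : C s j < posOf i₀
      i₀-present = ≰⇒> λ r₀≤ → 1+n≰n (subst (_≤ s) (trans (cong time (proj₂ i₀-located)) (time-binAtTime (suc s) (s≤s z≤n) s<n))
                                               (proj₁ (proj₂ inv j (posOf i₀) (proj₁ i₀-located)) r₀≤))

      -- the first bin b of q_j not yet removed is i₀: otherwise b precedes
      -- i₀, has time > s+1, and (2) is violated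
      no-gap : ¬ (suc (C s j) < posOf i₀)
      no-gap gap = one≰zero (subst₂ (λ a b → a ℤ.≤ + 1 ℤ.- b) (proj₂ (proj₂ i₀-spec)) (proj₂ (proj₂ b-time)) violated)
        where
        one≰zero : ¬ (+ 1 ℤ.≤ + 1 ℤ.- + 1)
        one≰zero (ℤ.+≤+ ())
        pos : Pos j (suc (C s j))
        pos = let (1≤j , j≤k , _ , r₀≤len) = proj₁ i₀-located in 1≤j , j≤k , s≤s z≤n , ≤-trans (<⇒≤ gap) r₀≤len
        b : ℕ
        b = binAt Q j (suc (C s j))
        b-time : (1 ≤ time b) × (time b ≤ n) × (x b (time b) ≡ + 1)
        b-time = time-at j _ pos
        b-late : suc s < time b
        b-late = ≤∧≢⇒< (≰⇒> λ time≤s → 1+n≰n (proj₂ (proj₂ inv j _ pos) time≤s)) λ s+1≡time →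
          <-irrefl (proj₂ (binAt-injective j _ j _ pos (proj₁ i₀-located)
                     (trans (time⇒binAtTime j _ (suc s) pos (s≤s z≤n) s<n (sym s+1≡time)) (sym (proj₂ i₀-located))))) gap
        b<i₀ : b < i₀
        b<i₀ = subst (b <_) (proj₂ i₀-located) (+-monoʳ-< (bd (j ∸ 1)) gap)
        violated : x i₀ (suc s) ℤ.≤ + 1 ℤ.- x b (time b)
        violated = in-order j b i₀ (time b) (suc s) (proj₁ pos , proj₁ (proj₂ pos))
                     (proj₁ (proj₂ (proj₂ (Pos⇒InSeq j _ pos)))) b<i₀
                     (subst (_≤ bd j) (proj₂ i₀-located) (proj₂ (proj₂ (proj₂ (Pos⇒InSeq j _ (proj₁ i₀-located))))))
                     (proj₁ b-time , proj₁ (proj₂ b-time)) (s≤s z≤n , s<n) b-late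

      i₀-next : posOf i₀ ≡ suc (C s j)
      i₀-next = ≤-antisym (≮⇒≥ no-gap) i₀-present

      next-pos : Pos j (suc (C s j))
      next-pos = subst (Pos j) i₀-next (proj₁ i₀-located)

      next-bin : binAt Q j (suc (C s j)) ≡ i₀
      next-bin = subst (λ r → binAt Q j r ≡ i₀) i₀-next (proj₂ i₀-located)

    invariant-step : ∀ s → (s<n : s < n) → RemovedExactly s → RemovedExactly (suc s)
    invariant-step s s<n inv@(bounded , exact) =
      step-InBounds (C s) j bounded (proj₂ (proj₂ (proj₂ next-pos))) , exact′
      where
      open NextBin s s<n inv
      time-s+1 : ∀ ℓ r → Pos ℓ r → time (binAt Q ℓ r) ≡ suc s → (ℓ ≡ j) × (r ≡ suc (C s j))
      time-s+1 ℓ r pos time≡ =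
        binAt-injective ℓ r j _ pos next-pos (trans (time⇒binAtTime ℓ r (suc s) pos (s≤s z≤n) s<n time≡) (sym next-bin))
      exact′ : ∀ ℓ r → Pos ℓ r → (r ≤ C (suc s) ℓ → time (binAt Q ℓ r) ≤ suc s) × (time (binAt Q ℓ r) ≤ suc s → r ≤ C (suc s) ℓ)
      exact′ ℓ r pos with ℓ ≟ j
      ... | yes refl rewrite step-here (C s) ℓ = removed⇒early , early⇒removed
        where
        removed⇒early : r ≤ suc (C s ℓ) → time (binAt Q ℓ r) ≤ suc s
        removed⇒early r≤ with r ≟ suc (C s ℓ)
        ... | yes refl = ≤-reflexive (trans (cong time next-bin) (time-binAtTime (suc s) (s≤s z≤n) s<n))
        ... | no r≢    = m≤n⇒m≤1+n (proj₁ (exact ℓ r pos) (≤-pred-≢ r≤ r≢))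
        early⇒removed : time (binAt Q ℓ r) ≤ suc s → r ≤ suc (C s ℓ)
        early⇒removed time≤ with time (binAt Q ℓ r) ≟ suc s
        ... | yes time≡ = ≤-reflexive (proj₂ (time-s+1 ℓ r pos time≡))
        ... | no time≢  = m≤n⇒m≤1+n (proj₂ (exact ℓ r pos) (≤-pred-≢ time≤ time≢))
      ... | no ℓ≢j rewrite step-elsewhere (C s) j ℓ ℓ≢j = (λ r≤ → m≤n⇒m≤1+n (proj₁ (exact ℓ r pos) r≤)) , early⇒removed
        where
        early⇒removed : time (binAt Q ℓ r) ≤ suc s → r ≤ C s ℓ
        early⇒removed time≤ with time (binAt Q ℓ r) ≟ suc s
        ... | yes time≡ = ⊥-elim (ℓ≢j (proj₁ (time-s+1 ℓ r pos time≡)))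
        ... | no time≢  = proj₂ (exact ℓ r pos) (≤-pred-≢ time≤ time≢)

    invariant : ∀ s → s ≤ n → RemovedExactly s
    invariant zero    _   = (λ _ _ _ → z≤n) , λ ℓ r pos →
      (λ r≤0 → ⊥-elim (<⇒≱ (proj₁ (proj₂ (proj₂ pos))) r≤0)) ,
      (λ time≤0 → ⊥-elim (<⇒≱ (proj₁ (time-at ℓ r pos)) time≤0))
    invariant (suc s) s<n = invariant-step s s<n (invariant s (<⇒≤ s<n))

    -- the configurations strictly between the first and last are the ILP's cut points
    cut-range : ∀ c → 1 ≤ c → c < n → (1 ≤ c) × (c ≤ n ∸ 1)
    cut-range c 1≤c c<n = 1≤c , suc[m]≤n⇒m≤pred[n] c<n

    module OpenPallet (c : ℕ) (1≤c : 1 ≤ c) (c<n : c < n) (t : ℕ) (t∈ : (1 ≤ t) × (t ≤ m)) where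

      c∈ : (1 ≤ c) × (c ≤ n ∸ 1)
      c∈ = cut-range c 1≤c c<n

      inv : RemovedExactly c
      inv = invariant c (<⇒≤ c<n)

      g-forced : T (anyIn 1 k (λ j → anyIn 1 (C c j) (λ r → plt (binAt Q j r) ≡ᵇ t))) → g t c ≡ + 1
      g-forced some with anyIn-elim 1 k _ some
      ... | ℓ , 1≤ℓ , ℓ≤k , someℓ with anyIn-elim 1 (C c ℓ) _ someℓ
      ...   | r , 1≤r , r≤ , plt≡ = forced-by-upper (g t c) (proj₁ (ghf-binary t c t∈ c∈))
                                      (subst (λ y → y ℤ.- g t c ℤ.≤ + 0) (proj₂ (proj₂ (time-at ℓ r pos))) removed-early)
        where
        pos : Pos ℓ r
        pos = 1≤ℓ , ℓ≤k , 1≤r , ≤-trans r≤ (proj₁ inv ℓ 1≤ℓ ℓ≤k)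
        removed-early : x (binAt Q ℓ r) (time (binAt Q ℓ r)) ℤ.- g t c ℤ.≤ + 0
        removed-early = g-bound t c _ _ t∈ c∈ (binAt-range ℓ r pos) (≡ᵇ⇒≡ _ _ plt≡)
                          (proj₁ (time-at ℓ r pos) , proj₁ (proj₂ (time-at ℓ r pos))) (proj₁ (proj₂ inv ℓ r pos) r≤)

      h-forced : T (anyIn 1 k (λ ℓ → anyIn (suc (C c ℓ)) (len Q ℓ) (λ r → plt (binAt Q ℓ r) ≡ᵇ t))) → h t c ≡ + 1
      h-forced some with anyIn-elim 1 k _ some
      ... | ℓ , 1≤ℓ , ℓ≤k , someℓ with anyIn-elim (suc (C c ℓ)) (len Q ℓ) _ someℓ
      ...   | r , c<r , r≤len , plt≡ = forced-by-upper (h t c) (proj₁ (proj₂ (ghf-binary t c t∈ c∈)))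
                                        (subst (λ y → y ℤ.- h t c ℤ.≤ + 0) (proj₂ (proj₂ (time-at ℓ r pos))) removed-late)
        where
        pos : Pos ℓ r
        pos = 1≤ℓ , ℓ≤k , ≤-trans (s≤s z≤n) c<r , r≤len
        removed-late : x (binAt Q ℓ r) (time (binAt Q ℓ r)) ℤ.- h t c ℤ.≤ + 0
        removed-late = h-bound t c _ _ t∈ c∈ (binAt-range ℓ r pos) (≡ᵇ⇒≡ _ _ plt≡)
                         (proj₁ (time-at ℓ r pos) , proj₁ (proj₂ (time-at ℓ r pos)))
                         (≰⇒> λ time≤c → 1+n≰n (≤-trans c<r (proj₂ (proj₂ inv ℓ r pos) time≤c)))

      f-forced : T (isOpen Q (C c) t) → f t c ≡ + 1
      f-forced open′ with to T-∧ open′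
      ... | some-removed , some-left =
        forced-by-sum (f t c) (proj₂ (proj₂ (ghf-binary t c t∈ c∈)))
          (subst₂ (λ a b → a ℤ.+ b ℤ.- f t c ℤ.≤ + 1) (g-forced some-removed) (h-forced some-left) (f-link t c t∈ c∈))

    sum-f : ∀ c → (1 ≤ c) × (c ≤ n ∸ 1) → sumTo m (λ t → f t c) ≡ + sumN m (λ t → ℤ.∣ f t c ∣)
    sum-f c c∈ = trans (sumTo-cong m _ _ λ t 1≤t t≤m → sym (ℤP.0≤i⇒+∣i∣≡i (proj₁ (proj₂ (proj₂ (ghf-binary t c (1≤t , t≤m) c∈))))))
                       (sumTo-+ m _)

    -- p is a natural number: by (3) at c = 1 it bounds a sum of binaries
    p-natural : p ≡ + ℤ.∣ p ∣
    p-natural = sym (ℤP.0≤i⇒+∣i∣≡i (ℤP.≤-trans (ℤ.+≤+ z≤n) (subst (ℤ._≤ p) (sum-f 1 1∈) (capacity 1 1∈))))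
      where
      1∈ : (1 ≤ 1) × (1 ≤ n ∸ 1)
      1∈ = cut-range 1 ≤-refl (nBins≥2 1≤k)

    open-bound-inner : ∀ c → 1 ≤ c → c < n → openCount Q (C c) ≤ ℤ.∣ p ∣
    open-bound-inner c 1≤c c<n = ℤP.drop‿+≤+ (begin
      + openCount Q (C c)                            ≡⟨ cong +_ (countUpTo-sum m (isOpen Q (C c))) ⟩
      + sumN m (λ t → ind (isOpen Q (C c) t))        ≤⟨ ℤ.+≤+ (sumN-mono m _ _ open⇒f) ⟩
      + sumN m (λ t → ℤ.∣ f t c ∣)                   ≡⟨ sum-f c (cut-range c 1≤c c<n) ⟨
      sumTo m (λ t → f t c)                          ≤⟨ capacity c (cut-range c 1≤c c<n) ⟩
      p                                              ≡⟨ p-natural ⟩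
      + ℤ.∣ p ∣                                      ∎)
      where
      open ℤP.≤-Reasoning
      open⇒f : ∀ t → 1 ≤ t → t ≤ m → ind (isOpen Q (C c) t) ≤ ℤ.∣ f t c ∣
      open⇒f t 1≤t t≤m with T? (isOpen Q (C c) t)
      ... | no ¬open  rewrite ¬T⇒≡false ¬open = z≤n
      ... | yes open′ rewrite to T-≡ open′ | OpenPallet.f-forced c 1≤c c<n t (1≤t , t≤m) open′ = ≤-refl

    C-final : Final (C n)
    C-final ℓ 1≤ℓ ℓ≤k with invariant n ≤-refl
    ... | bounded , exact = ≤-antisym (bounded ℓ 1≤ℓ ℓ≤k)
                              (proj₂ (exact ℓ (len Q ℓ) pos) (proj₁ (proj₂ (time-at ℓ (len Q ℓ) pos))))
      where
      pos : Pos ℓ (len Q ℓ)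
      pos = 1≤ℓ , ℓ≤k , len≥1 ℓ 1≤ℓ ℓ≤k , ≤-refl

    no-open-initial : openCount Q (C 0) ≡ 0
    no-open-initial = countUpTo-none m _ λ t _ _ open′ →
      let (ℓ , _ , _ , someℓ) = anyIn-elim 1 k _ (proj₁ (to T-∧ open′))
          (r , 1≤r , r≤0 , _) = anyIn-elim 1 0 (λ r → plt (binAt Q ℓ r) ≡ᵇ t) someℓ
      in <⇒≱ 1≤r r≤0

    no-open-final : openCount Q (C n) ≡ 0
    no-open-final = countUpTo-none m _ λ t _ _ open′ →
      let (ℓ , 1≤ℓ , ℓ≤k , someℓ) = anyIn-elim 1 k _ (proj₂ (to T-∧ open′))
          (r , C<r , r≤len , _) = anyIn-elim (suc (C n ℓ)) (len Q ℓ) _ someℓ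
      in 1+n≰n (≤-trans C<r (subst (r ≤_) (sym (C-final ℓ 1≤ℓ ℓ≤k)) r≤len))

    open-bound : ∀ s → s ≤ n → openCount Q (C s) ≤ ℤ.∣ p ∣
    open-bound zero    _ = subst (_≤ ℤ.∣ p ∣) (sym no-open-initial) z≤n
    open-bound (suc s) s<n with suc s ≟ n
    ... | yes s+1≡n = subst (λ s′ → openCount Q (C s′) ≤ ℤ.∣ p ∣) (sym s+1≡n) (subst (_≤ ℤ.∣ p ∣) (sym no-open-final) z≤n)
    ... | no s+1≢n = open-bound-inner (suc s) (s≤s z≤n) (≤∧≢⇒< s<n s+1≢n)

    run-from : ∀ r s → s + r ≡ n → RunBounded Q ℤ.∣ p ∣ (C s) (steps (suc s) r)
    run-from zero    s s+0≡n rewrite +-identityʳ s | s+0≡n = open-bound n ≤-refl , C-final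
    run-from (suc r) s s+r≡n =
      open-bound s (<⇒≤ s<n) , proj₁ pos , proj₁ (proj₂ pos) , proj₂ (proj₂ (proj₂ pos)) ,
      run-from r (suc s) (trans (sym (+-suc s r)) s+r≡n)
      where
      s<n : s < n
      s<n = subst (s <_) s+r≡n (m<m+n s (s≤s z≤n))
      pos : Pos (seqAtTime (suc s)) (suc (C s (seqAtTime (suc s))))
      pos = NextBin.next-pos s s<n (invariant s (<⇒≤ s<n))

    processing : Σ ℕ λ q → (p ≡ + q) × ProcessableWith Q q
    processing = ℤ.∣ p ∣ , p-natural , steps 1 n , run-from n 0 refl

  processing-of-feasible : 1 ≤ k → Feasible Q A → Σ ℕ λ q → (p ≡ + q) × ProcessableWith Q q
  processing-of-feasible 1≤k (x01 , ghf01 , rows , columns , in-order , _ , capacity , g-bound , _ , h-bound , _ , link) =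
    Reconstruction.processing 1≤k x01 ghf01 rows columns in-order capacity g-bound h-bound
                              (λ t c t∈ c∈ → proj₂ (proj₂ (link t c t∈ c∈)))

theorem6 : (Q : Instance) → 1 ≤ Instance.k Q →
           Σ ℕ λ v → IsILPOptimum Q (+ v) × IsMinProcessing Q v
theorem6 Q 1≤k with Runs.optimal-processing Q
... | v , (js , run) , v-least = v , (attained , lower-bound) , ((js , run) , v-least)
  where
  attained : Σ Assignment λ A → Feasible Q A × Assignment.p A ≡ + v
  attained = RunToAssignment.assignment Q v js run , RunToAssignment.feasible Q v js run , refl
  lower-bound : ∀ A → Feasible Q A → + v ℤ.≤ Assignment.p A
  lower-bound A feasible with AssignmentToRun.processing-of-feasible Q A 1≤k feasible
  ... | q , p≡q , processable = subst (+ v ℤ.≤_) (sym p≡q) (ℤ.+≤+ (v-least q processable))
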